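{- For every positive integer $m$ there exist $m$ pairwise non-isomorphic simple matroids whose Orlik–Solomon algebras are all isomorphic as graded algebras.
   Context: For a simple matroid $M$ on a finite ground set $E$ and a fixed commutative coefficient ring $K$, let $\Lambda(E)$ be the exterior algebra over $K$ generated by degree-one elements $e_i$, $i\in E$. Define the $K$-linear map $\partial:\Lambda(E)\to\Lambda(E)$ by $\partial(e_{i_1}\cdots e_{i_k})=\sum_{j=1}^k(-1)^{j-1}e_{i_1}\cdots\widehat{e_{i_j}}\cdots e_{i_k}$. Let $I(M)$ be the ideal generated by all $\partial(e_{i_1}\cdots e_{i_k})$ with $\{i_1,\dots,i_k\}$ a circuit of $M$. The Orlik–Solomon algebra is the graded algebra $A(M)=\Lambda(E)/I(M)$. -}

module Defs where

open import Level using (Level; _⊔_) renaming (suc to lsuc; zero to lzero)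
open import Data.Nat using (ℕ; zero; suc; _<_; _≤_)
open import Data.Bool using (Bool; true; false)
open import Data.Fin using (Fin)
open import Data.Fin.Subset using (Subset; _∈_; _∉_; _⊆_; _⊂_; ∣_∣; ⁅_⁆; _∪_; ⊥)
open import Data.Vec using (Vec; []; _∷_; lookup; tabulate)
open import Data.List using (List; []; _∷_; _++_; map; foldr)
open import Data.List.Relation.Unary.All using (All)
open import Data.Product using (Σ; ∃; _×_; _,_; proj₁; proj₂)
open import Function.Bundles using (_↔_; Inverse; _⇔_)
open import Relation.Nullary using (¬_)
open import Relation.Binary.PropositionalEquality using (_≡_; _≢_)
open import Algebra.Bundles using (CommutativeRing)

record Matroid (n : ℕ) : Set₁ where
  field
    Indep      : Subset n → Set
    indep-∅    : Indep ⊥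
    indep-⊆    : ∀ {A B} → B ⊆ A → Indep A → Indep B
    indep-exch : ∀ {A B} → Indep A → Indep B → ∣ A ∣ < ∣ B ∣ →
                 ∃ λ x → x ∈ B × x ∉ A × Indep (A ∪ ⁅ x ⁆)

  IsCircuit : Subset n → Set
  IsCircuit C = ¬ Indep C × (∀ D → D ⊂ C → Indep D)

open Matroid public

-- simple: no loops and no parallel elements, i.e. every set of size ≤ 2 is independent
Simple : ∀ {n} → Matroid n → Set
Simple {n} M = ∀ (A : Subset n) → ∣ A ∣ ≤ 2 → Indep M A

image : ∀ {n n'} → Fin n ↔ Fin n' → Subset n → Subset n'
image σ S = tabulate (λ y → lookup S (Inverse.from σ y))

_≅M_ : ∀ {n n'} → Matroid n → Matroid n' → Set
_≅M_ {n} {n'} M M' =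
  Σ (Fin n ↔ Fin n') λ σ → ∀ (S : Subset n) → (Indep M S → Indep M' (image σ S)) × (Indep M' (image σ S) → Indep M S)

module OS {c ℓ : Level} (K : CommutativeRing c ℓ) where
  open CommutativeRing K

  allSubsets : ∀ n → List (Subset n)
  allSubsets zero    = [] ∷ []
  allSubsets (suc n) = map (true ∷_) (allSubsets n) ++ map (false ∷_) (allSubsets n)

  sumL : List Carrier → Carrier
  sumL = foldr _+_ 0#

  signPow : ℕ → Carrier
  signPow zero    = 1#
  signPow (suc k) = - signPow k

  δ : ∀ {n} → Subset n → Subset n → Carrier
  δ []          []          = 1#
  δ (true ∷ S)  (true ∷ U)  = δ S U
  δ (false ∷ S) (false ∷ U) = δ S U
  δ (true ∷ S)  (false ∷ U) = 0#
  δ (false ∷ S) (true ∷ U)  = 0#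

  -- Λ(E) for E = Fin n: a free K-module with basis the monomials
  -- e_S = e_{i₁} ⋯ e_{iₖ} (i₁ < ⋯ < iₖ, S = {i₁,…,iₖ}); an element is its
  -- coefficient function.
  Λ : ℕ → Set c
  Λ n = Subset n → Carrier

  -- coefficient of e_U in the product e_S e_T
  coef : ∀ {n} → Subset n → Subset n → Subset n → Carrier
  coef []          []          []          = 1#
  coef (true ∷ S)  (true ∷ T)  U           = 0#
  coef (true ∷ S)  (false ∷ T) (true ∷ U)  = coef S T U
  coef (true ∷ S)  (false ∷ T) (false ∷ U) = 0#
  coef (false ∷ S) (true ∷ T)  (true ∷ U)  = signPow ∣ S ∣ * coef S T U
  coef (false ∷ S) (true ∷ T)  (false ∷ U) = 0#
  coef (false ∷ S) (false ∷ T) (false ∷ U) = coef S T U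
  coef (false ∷ S) (false ∷ T) (true ∷ U)  = 0#

  _+Λ_ : ∀ {n} → Λ n → Λ n → Λ n
  (x +Λ y) U = x U + y U

  -Λ_ : ∀ {n} → Λ n → Λ n
  (-Λ x) U = - x U

  _·Λ_ : ∀ {n} → Carrier → Λ n → Λ n
  (a ·Λ x) U = a * x U

  _*Λ_ : ∀ {n} → Λ n → Λ n → Λ n
  _*Λ_ {n} x y U =
    sumL (map (λ S → sumL (map (λ T → x S * y T * coef S T U) (allSubsets n))) (allSubsets n))

  1Λ : ∀ {n} → Λ n
  1Λ = δ ⊥

  -- ∂(e_{i₁} ⋯ e_{iₖ}) = Σⱼ (-1)^{j-1} e_{i₁} ⋯ ê_{iⱼ} ⋯ e_{iₖ}, for i₁ < ⋯ < iₖ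
  ∂e : ∀ {n} → Subset n → Λ n
  ∂e []          U           = 0#
  ∂e (true ∷ S)  (false ∷ U) = δ S U
  ∂e (true ∷ S)  (true ∷ U)  = - ∂e S U
  ∂e (false ∷ S) (false ∷ U) = ∂e S U
  ∂e (false ∷ S) (true ∷ U)  = 0#

  -- membership in the two-sided ideal I(M) generated by the ∂ e_C, C a circuit
  InI : ∀ {n} → Matroid n → Λ n → Set (c ⊔ ℓ)
  InI {n} M z =
    Σ (List (Λ n × Subset n × Λ n)) λ gs →
      All (λ g → IsCircuit M (proj₁ (proj₂ g))) gs ×
      (∀ U → z U ≈ sumL (map (λ g → (proj₁ g *Λ (∂e (proj₁ (proj₂ g)) *Λ proj₂ (proj₂ g))) U) gs))

  -- equality in A(M) = Λ(E)/I(M)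
  _~[_]_ : ∀ {n} → Λ n → Matroid n → Λ n → Set (c ⊔ ℓ)
  x ~[ M ] y = InI M (x +Λ (-Λ y))

  Homog : ∀ {n} → ℕ → Λ n → Set ℓ
  Homog k x = ∀ U → ∣ U ∣ ≢ k → x U ≈ 0#

  -- isomorphism of graded K-algebras A(M) ≅ A(M'), with maps given on
  -- representatives and all equations holding in the quotients
  record OSIso {n n'} (M : Matroid n) (M' : Matroid n') : Set (c ⊔ ℓ) where
    field
      φ       : Λ n → Λ n'
      ψ       : Λ n' → Λ n
      φ-resp  : ∀ x y → x ~[ M ] y → φ x ~[ M' ] φ y
      ψ-resp  : ∀ x y → x ~[ M' ] y → ψ x ~[ M ] ψ y
      φ-+     : ∀ x y → φ (x +Λ y) ~[ M' ] (φ x +Λ φ y)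
      φ-·     : ∀ a x → φ (a ·Λ x) ~[ M' ] (a ·Λ φ x)
      φ-*     : ∀ x y → φ (x *Λ y) ~[ M' ] (φ x *Λ φ y)
      φ-1     : φ 1Λ ~[ M' ] 1Λ
      φ-grade : ∀ k x → Homog k x → Σ (Λ n') λ y → Homog k y × (φ x ~[ M' ] y)
      ψφ      : ∀ x → ψ (φ x) ~[ M ] x
      φψ      : ∀ y → φ (ψ y) ~[ M' ] y

{-# OPTIONS --safe #-}
module Submission where

-- The building blocks are two simple matroids on six points: a skew block, whose circuits are
-- the disjoint lines {0,1,2} and {3,4,5}, and a meeting block, whose circuits are the lines
-- {0,1,2} and {0,3,4} of a plane and {1,2,3,4}, with 5 a coloop. The i-th matroid is a direct
-- sum of m blocks of which i are meeting blocks; it is simple, and the number of coloops tells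
-- these matroids apart. Their Orlik–Solomon algebras are all isomorphic: on a block, the
-- substitution e₃ ↦ e₃ + e₅ − e₀, e₄ ↦ e₄ + e₅ − e₀ (inverse: the same with e₀ − e₅) fixes
-- ∂(e₀e₁e₂) and, since ∂(abc) = (a − b)(b − c) in degree one, sends ∂(e₃e₄e₅) to
-- (e₃ − e₄)(e₄ − e₀) = ∂(e₀e₃e₄); its inverse sends ∂(e₁e₂e₃e₄) into the ideal generated by
-- ∂(e₀e₁e₂) and ∂(e₃e₄e₅). Applied blockwise, these substitutions are mutually inverse graded
-- algebra automorphisms of the exterior algebra carrying each Orlik–Solomon ideal into the other.

open import Defs
open import Level using (Level)
open import Algebra.Bundles using (AbelianGroup; CommutativeRing; Ring)
open import Data.Fin using (Fin; toℕ)
open import Data.Fin.Properties using (toℕ-injective; toℕ≤n)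
open import Data.Nat using (ℕ; _≤_) renaming (_*_ to _*ℕ_)
open import Data.Product using (Σ; _×_; _,_)
open import Data.Vec using (Vec)
open import Function using (_∘_)
open import Relation.Nullary using (¬_)
open import Relation.Binary.PropositionalEquality using (_≢_) renaming (sym to ≡-sym; trans to ≡-trans)

module Matroids where

  open import Data.Bool using (T; _∨_)
  open import Data.Bool.Properties using (T-≡)
  open import Data.Unit using (⊤; tt)
  open import Data.Fin using (Fin; zero; suc; _↑ˡ_; _↑ʳ_; splitAt; join)
  open import Data.Fin.Patterns using (5F)
  open import Data.Fin.Properties
    using (↑ˡ-injective; ↑ʳ-injective; splitAt-↑ˡ; splitAt-↑ʳ; cantor-schröder-bernstein; any?; all?)
    renaming (_≟_ to _≟ᶠ_)
  open import Data.Fin.Subset using (Subset; inside; outside; _∈_; _∉_; _⊆_; _⊂_; ∣_∣; ⁅_⁆; _∪_; ⊥; Nonempty)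
  open import Data.Fin.Subset.Properties
    using (∉⊥; x∈⁅y⁆⇔x≡y; _∈?_; _⊆?_; _⊂?_; ⊆-refl; ⊆-trans; ⊆-antisym; ⊆-⊂-trans; nonempty?; Empty-unique; ∪-identityʳ)
  open import Data.List using (List; []; _∷_)
  open import Data.List.Membership.Propositional using (find; lose) renaming (_∈_ to _∈ᴸ_)
  open import Data.List.Relation.Unary.All using (All) renaming (lookup to lookupᴬ; all? to allᴬ?)
  open import Data.List.Relation.Unary.Any using (Any; here; there) renaming (any? to anyᴸ?; map to mapᴬ)
  open import Data.Nat using (ℕ; zero; suc; _+_; _*_; _≤_; _<_; _≤?_; _<?_; z≤n; s≤s)
  open import Data.Nat.Properties using (≤-trans; m≤m+n; m≤n+m; +-mono-≤; ≮⇒≥; <⇒≱)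
  open import Data.Product using (∃; _×_; _,_; proj₁; proj₂)
  open import Data.Sum using (_⊎_; inj₁; inj₂)
  import Data.Sum as Sum
  open import Data.Vec using (Vec; []; _∷_; _++_; take; drop; here; there; lookup; tabulate; map; sum)
  open import Data.Vec.Properties
    using (take-zipWith; drop-zipWith; take++drop≡id; ++-injective; lookup∘tabulate; tabulate∘lookup; tabulate-cong; lookup-zipWith; lookup⇒[]=; []=⇒lookup)
  open import Function using (_∘_; id; _↔_; Inverse; _⇔_; mk⇔; Equivalence)
  open import Function.Definitions using (Injective)
  open import Relation.Nullary using (¬_; Dec; yes; no; contradiction)
  open import Relation.Nullary.Decidable using (from-yes; map′; _×-dec_; _→-dec_; ¬?; decidable-stable; does-⇔; T?)
  open import Relation.Unary using (Pred; Decidable)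
  open import Relation.Binary.PropositionalEquality using (_≡_; _≢_; refl; sym; trans; cong; cong₂; subst; subst₂; module ≡-Reasoning)

  data SumView (a n : ℕ) : Fin (a + n) → Set where
    inl : ∀ q → SumView a n (q ↑ˡ n)
    inr : ∀ y → SumView a n (a ↑ʳ y)

  sumView : ∀ a {n} (x : Fin (a + n)) → SumView a n x
  sumView zero    y       = inr y
  sumView (suc a) zero    = inl zero
  sumView (suc a) (suc x) with sumView a x
  ... | inl q = inl (suc q)
  ... | inr y = inr y

  ↑ˡ≢↑ʳ : ∀ {a n} (q : Fin a) (y : Fin n) → q ↑ˡ n ≢ a ↑ʳ y
  ↑ˡ≢↑ʳ {a} {n} q y eq with trans (sym (splitAt-↑ˡ a q n)) (trans (cong (splitAt a) eq) (splitAt-↑ʳ a n y))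
  ... | ()

  ∈-++⁺ˡ : ∀ {a n} {B : Subset a} {C : Subset n} {q} → q ∈ B → q ↑ˡ n ∈ B ++ C
  ∈-++⁺ˡ here      = here
  ∈-++⁺ˡ (there p) = there (∈-++⁺ˡ p)

  ∈-++⁺ʳ : ∀ {a n} (B : Subset a) {C : Subset n} {y} → y ∈ C → a ↑ʳ y ∈ B ++ C
  ∈-++⁺ʳ []      p = p
  ∈-++⁺ʳ (_ ∷ B) p = there (∈-++⁺ʳ B p)

  ∈-++⁻ˡ : ∀ {a n} (B : Subset a) {C : Subset n} {q} → q ↑ˡ n ∈ B ++ C → q ∈ B
  ∈-++⁻ˡ (_ ∷ B) {q = zero}  here      = here
  ∈-++⁻ˡ (_ ∷ B) {q = suc q} (there p) = there (∈-++⁻ˡ B p)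

  ∈-++⁻ʳ : ∀ {a n} (B : Subset a) {C : Subset n} {y} → a ↑ʳ y ∈ B ++ C → y ∈ C
  ∈-++⁻ʳ []      p         = p
  ∈-++⁻ʳ (_ ∷ B) (there p) = ∈-++⁻ʳ B p

  ++-⊆ : ∀ {a n} {B B′ : Subset a} {C C′ : Subset n} → B ⊆ B′ → C ⊆ C′ → B ++ C ⊆ B′ ++ C′
  ++-⊆ {a} {B = B} {B′} B⊆B′ C⊆C′ {x} x∈ with sumView a x
  ... | inl q = ∈-++⁺ˡ (B⊆B′ (∈-++⁻ˡ B x∈))
  ... | inr y = ∈-++⁺ʳ B′ (C⊆C′ (∈-++⁻ʳ B x∈))

  ++-⊂ˡ : ∀ {a n} {B B′ : Subset a} {C : Subset n} → B ⊂ B′ → B ++ C ⊂ B′ ++ C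
  ++-⊂ˡ {B = B} (B⊆B′ , q , q∈B′ , q∉B) = ++-⊆ B⊆B′ id , _ , ∈-++⁺ˡ q∈B′ , q∉B ∘ ∈-++⁻ˡ B

  ++-⊂ʳ : ∀ {a n} {B : Subset a} {C C′ : Subset n} → C ⊂ C′ → B ++ C ⊂ B ++ C′
  ++-⊂ʳ {B = B} (C⊆C′ , y , y∈C′ , y∉C) = ++-⊆ id C⊆C′ , _ , ∈-++⁺ʳ B y∈C′ , y∉C ∘ ∈-++⁻ʳ B

  ⊥⊂ : ∀ {n} {C : Subset n} → Nonempty C → ⊥ ⊂ C
  ⊥⊂ (y , y∈C) = (λ p → contradiction p ∉⊥) , y , y∈C , ∉⊥

  ⊆⊥⇒≡⊥ : ∀ {n} {C : Subset n} → C ⊆ ⊥ → C ≡ ⊥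
  ⊆⊥⇒≡⊥ C⊆⊥ = Empty-unique (λ (y , y∈C) → ∉⊥ (C⊆⊥ y∈C))

  ++⊂++⊥ : ∀ {a n} {B B′ : Subset a} {C : Subset n} → B ++ C ⊂ B′ ++ ⊥ → B ⊂ B′ × C ≡ ⊥
  ++⊂++⊥ {a} {B = B} {B′} (BC⊆ , x , x∈ , x∉) =
    (B⊆B′ , witness (sumView a x) x∈ x∉) , ⊆⊥⇒≡⊥ (∈-++⁻ʳ B′ ∘ BC⊆ ∘ ∈-++⁺ʳ B)
    where
    B⊆B′ : B ⊆ B′
    B⊆B′ = ∈-++⁻ˡ B′ ∘ BC⊆ ∘ ∈-++⁺ˡ
    witness : ∀ {x} → SumView a _ x → x ∈ B′ ++ ⊥ → x ∉ B ++ _ → ∃ λ q → q ∈ B′ × q ∉ B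
    witness (inl q) x∈ x∉ = q , ∈-++⁻ˡ B′ x∈ , x∉ ∘ ∈-++⁺ˡ
    witness (inr y) x∈ x∉ = contradiction (∈-++⁻ʳ B′ x∈) ∉⊥

  ++⊂⊥++ : ∀ {a n} {B : Subset a} {C C′ : Subset n} → B ++ C ⊂ ⊥ ++ C′ → B ≡ ⊥ × C ⊂ C′
  ++⊂⊥++ {a} {B = B} {C = C} {C′} (BC⊆ , x , x∈ , x∉) =
    ⊆⊥⇒≡⊥ (∈-++⁻ˡ ⊥ ∘ BC⊆ ∘ ∈-++⁺ˡ) , (C⊆C′ , witness (sumView a x) x∈ x∉)
    where
    C⊆C′ : C ⊆ C′
    C⊆C′ = ∈-++⁻ʳ ⊥ ∘ BC⊆ ∘ ∈-++⁺ʳ B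
    witness : ∀ {x} → SumView a _ x → x ∈ ⊥ ++ C′ → x ∉ B ++ C → ∃ λ y → y ∈ C′ × y ∉ C
    witness (inl q) x∈ x∉ = contradiction (∈-++⁻ˡ ⊥ x∈) ∉⊥
    witness (inr y) x∈ x∉ = y , ∈-++⁻ʳ ⊥ x∈ , x∉ ∘ ∈-++⁺ʳ B

  module _ (a : ℕ) {n : ℕ} where

    take-++ : ∀ (B : Subset a) (C : Subset n) → take a (B ++ C) ≡ B
    take-++ B C = proj₁ (++-injective (take a (B ++ C)) B (take++drop≡id a (B ++ C)))

    drop-++ : ∀ (B : Subset a) (C : Subset n) → drop a (B ++ C) ≡ C
    drop-++ B C = proj₂ (++-injective (take a (B ++ C)) B (take++drop≡id a (B ++ C)))

    ↑ˡ∈⇒∈take : ∀ {A : Subset (a + n)} {q} → q ↑ˡ n ∈ A → q ∈ take a A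
    ↑ˡ∈⇒∈take {A} p = ∈-++⁻ˡ (take a A) (subst (_ ∈_) (sym (take++drop≡id a A)) p)

    ∈take⇒↑ˡ∈ : ∀ {A : Subset (a + n)} {q} → q ∈ take a A → q ↑ˡ n ∈ A
    ∈take⇒↑ˡ∈ {A} p = subst (_ ∈_) (take++drop≡id a A) (∈-++⁺ˡ p)

    ↑ʳ∈⇒∈drop : ∀ {A : Subset (a + n)} {y} → a ↑ʳ y ∈ A → y ∈ drop a A
    ↑ʳ∈⇒∈drop {A} p = ∈-++⁻ʳ (take a A) (subst (_ ∈_) (sym (take++drop≡id a A)) p)

    ∈drop⇒↑ʳ∈ : ∀ {A : Subset (a + n)} {y} → y ∈ drop a A → a ↑ʳ y ∈ A
    ∈drop⇒↑ʳ∈ {A} p = subst (_ ∈_) (take++drop≡id a A) (∈-++⁺ʳ (take a A) p)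

    take-⊆ : ∀ {A B : Subset (a + n)} → B ⊆ A → take a B ⊆ take a A
    take-⊆ B⊆A = ↑ˡ∈⇒∈take ∘ B⊆A ∘ ∈take⇒↑ˡ∈

    drop-⊆ : ∀ {A B : Subset (a + n)} → B ⊆ A → drop a B ⊆ drop a A
    drop-⊆ B⊆A = ↑ʳ∈⇒∈drop ∘ B⊆A ∘ ∈drop⇒↑ʳ∈

  ∣take∣+∣drop∣ : ∀ a {n} (A : Subset (a + n)) → ∣ take a A ∣ + ∣ drop a A ∣ ≡ ∣ A ∣
  ∣take∣+∣drop∣ zero    A             = refl
  ∣take∣+∣drop∣ (suc a) (inside ∷ A)  = cong suc (∣take∣+∣drop∣ a A)
  ∣take∣+∣drop∣ (suc a) (outside ∷ A) = ∣take∣+∣drop∣ a A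

  take-⊥ : ∀ a {n} → take a (⊥ {a + n}) ≡ ⊥
  take-⊥ zero    = refl
  take-⊥ (suc a) = cong (outside ∷_) (take-⊥ a)

  drop-⊥ : ∀ a {n} → drop a (⊥ {a + n}) ≡ ⊥
  drop-⊥ zero    = refl
  drop-⊥ (suc a) = drop-⊥ a

  take-⁅↑ˡ⁆ : ∀ {a n} (q : Fin a) → take a ⁅ q ↑ˡ n ⁆ ≡ ⁅ q ⁆
  take-⁅↑ˡ⁆ {suc a} zero    = cong (inside ∷_) (take-⊥ a)
  take-⁅↑ˡ⁆ {suc a} (suc q) = cong (outside ∷_) (take-⁅↑ˡ⁆ q)

  drop-⁅↑ˡ⁆ : ∀ {a n} (q : Fin a) → drop a ⁅ q ↑ˡ n ⁆ ≡ ⊥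
  drop-⁅↑ˡ⁆ {suc a} zero    = drop-⊥ a
  drop-⁅↑ˡ⁆ {suc a} (suc q) = drop-⁅↑ˡ⁆ q

  take-⁅↑ʳ⁆ : ∀ a {n} (y : Fin n) → take a ⁅ a ↑ʳ y ⁆ ≡ ⊥
  take-⁅↑ʳ⁆ zero    y = refl
  take-⁅↑ʳ⁆ (suc a) y = cong (outside ∷_) (take-⁅↑ʳ⁆ a y)

  drop-⁅↑ʳ⁆ : ∀ a {n} (y : Fin n) → drop a ⁅ a ↑ʳ y ⁆ ≡ ⁅ y ⁆
  drop-⁅↑ʳ⁆ zero    y = refl
  drop-⁅↑ʳ⁆ (suc a) y = drop-⁅↑ʳ⁆ a y

  module _ (a : ℕ) {n : ℕ} (A : Subset (a + n)) where

    take-∪⁅↑ˡ⁆ : ∀ q → take a (A ∪ ⁅ q ↑ˡ n ⁆) ≡ take a A ∪ ⁅ q ⁆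
    take-∪⁅↑ˡ⁆ q = trans (take-zipWith _∨_ A _) (cong (take a A ∪_) (take-⁅↑ˡ⁆ q))

    drop-∪⁅↑ˡ⁆ : ∀ q → drop a (A ∪ ⁅ q ↑ˡ n ⁆) ≡ drop a A
    drop-∪⁅↑ˡ⁆ q = trans (drop-zipWith _∨_ A _) (trans (cong (drop a A ∪_) (drop-⁅↑ˡ⁆ q)) (∪-identityʳ (drop a A)))

    take-∪⁅↑ʳ⁆ : ∀ y → take a (A ∪ ⁅ a ↑ʳ y ⁆) ≡ take a A
    take-∪⁅↑ʳ⁆ y = trans (take-zipWith _∨_ A _) (trans (cong (take a A ∪_) (take-⁅↑ʳ⁆ a y)) (∪-identityʳ (take a A)))

    drop-∪⁅↑ʳ⁆ : ∀ y → drop a (A ∪ ⁅ a ↑ʳ y ⁆) ≡ drop a A ∪ ⁅ y ⁆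
    drop-∪⁅↑ʳ⁆ y = trans (drop-zipWith _∨_ A _) (cong (drop a A ∪_) (drop-⁅↑ʳ⁆ a y))

  -- Direct sums of matroids

  +-<-split : ∀ {m n m′ n′} → m + n < m′ + n′ → m < m′ ⊎ n < n′
  +-<-split {m} {n} {m′} {n′} lt with m <? m′ | n <? n′
  ... | yes m<m′ | _       = inj₁ m<m′
  ... | no _     | yes n<n′ = inj₂ n<n′
  ... | no m≮m′  | no n≮n′  = contradiction (+-mono-≤ (≮⇒≥ m≮m′) (≮⇒≥ n≮n′)) (<⇒≱ lt)

  module DirectSum {a n : ℕ} (L : Matroid a) (M : Matroid n) where

    Indep⊕ : Subset (a + n) → Set
    Indep⊕ A = Indep L (take a A) × Indep M (drop a A)

    insertˡ : ∀ {A} q → Indep L (take a A ∪ ⁅ q ⁆) → Indep M (drop a A) → Indep⊕ (A ∪ ⁅ q ↑ˡ n ⁆)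
    insertˡ {A} q iL iM = subst (Indep L) (sym (take-∪⁅↑ˡ⁆ a A q)) iL , subst (Indep M) (sym (drop-∪⁅↑ˡ⁆ a A q)) iM

    insertʳ : ∀ {A} y → Indep L (take a A) → Indep M (drop a A ∪ ⁅ y ⁆) → Indep⊕ (A ∪ ⁅ a ↑ʳ y ⁆)
    insertʳ {A} y iL iM = subst (Indep L) (sym (take-∪⁅↑ʳ⁆ a A y)) iL , subst (Indep M) (sym (drop-∪⁅↑ʳ⁆ a A y)) iM

    insertˡ⁻ : ∀ {A} q → Indep⊕ (A ∪ ⁅ q ↑ˡ n ⁆) → Indep L (take a A ∪ ⁅ q ⁆)
    insertˡ⁻ {A} q (iL , _) = subst (Indep L) (take-∪⁅↑ˡ⁆ a A q) iL

    insertʳ⁻ : ∀ {A} y → Indep⊕ (A ∪ ⁅ a ↑ʳ y ⁆) → Indep M (drop a A ∪ ⁅ y ⁆)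
    insertʳ⁻ {A} y (_ , iM) = subst (Indep M) (drop-∪⁅↑ʳ⁆ a A y) iM

    indep⊕-exch : ∀ {A B} → Indep⊕ A → Indep⊕ B → ∣ A ∣ < ∣ B ∣ →
                  ∃ λ x → x ∈ B × x ∉ A × Indep⊕ (A ∪ ⁅ x ⁆)
    indep⊕-exch {A} {B} (iAL , iAM) (iBL , iBM) ∣A∣<∣B∣
      with +-<-split (subst₂ _<_ (sym (∣take∣+∣drop∣ a A)) (sym (∣take∣+∣drop∣ a B)) ∣A∣<∣B∣)
    ... | inj₁ lt = let q , q∈B , q∉A , iL = indep-exch L iAL iBL lt in
      q ↑ˡ n , ∈take⇒↑ˡ∈ a q∈B , q∉A ∘ ↑ˡ∈⇒∈take a , insertˡ q iL iAM
    ... | inj₂ lt = let y , y∈B , y∉A , iM = indep-exch M iAM iBM lt in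
      a ↑ʳ y , ∈drop⇒↑ʳ∈ a y∈B , y∉A ∘ ↑ʳ∈⇒∈drop a , insertʳ y iAL iM

  infixr 6 _⊕_

  _⊕_ : ∀ {a n} → Matroid a → Matroid n → Matroid (a + n)
  _⊕_ {a} L M = record
    { Indep      = Indep⊕
    ; indep-∅    = subst (Indep L) (sym (take-⊥ a)) (indep-∅ L) , subst (Indep M) (sym (drop-⊥ a)) (indep-∅ M)
    ; indep-⊆    = λ B⊆A (iL , iM) → indep-⊆ L (take-⊆ a B⊆A) iL , indep-⊆ M (drop-⊆ a B⊆A) iM
    ; indep-exch = indep⊕-exch
    }
    where open DirectSum L M

  module _ {a n : ℕ} (L : Matroid a) (M : Matroid n) where
    open DirectSum L M

    indep-++ : ∀ {B C} → Indep L B → Indep M C → Indep (L ⊕ M) (B ++ C)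
    indep-++ {B} {C} iB iC = subst (Indep L) (sym (take-++ a B C)) iB , subst (Indep M) (sym (drop-++ a B C)) iC

    indep-++⁻ : ∀ {B C} → Indep (L ⊕ M) (B ++ C) → Indep L B × Indep M C
    indep-++⁻ {B} {C} (iB , iC) = subst (Indep L) (take-++ a B C) iB , subst (Indep M) (drop-++ a B C) iC

    simple-⊕ : Simple L → Simple M → Simple (L ⊕ M)
    simple-⊕ sL sM A ∣A∣≤2 = sL _ (≤-trans (m≤m+n _ _) ∣A∣≤2′) , sM _ (≤-trans (m≤n+m _ _) ∣A∣≤2′)
      where
      ∣A∣≤2′ : ∣ take a A ∣ + ∣ drop a A ∣ ≤ 2
      ∣A∣≤2′ = subst (_≤ 2) (sym (∣take∣+∣drop∣ a A)) ∣A∣≤2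

    circuit-++⊥ : ∀ {B} → IsCircuit L B → IsCircuit (L ⊕ M) (B ++ ⊥)
    circuit-++⊥ {B} (dep , min) = dep ∘ proj₁ ∘ indep-++⁻ , minimal
      where
      minimal : ∀ D → D ⊂ B ++ ⊥ → Indep (L ⊕ M) D
      minimal D D⊂ with ++⊂++⊥ (subst (_⊂ B ++ ⊥) (sym (take++drop≡id a D)) D⊂)
      ... | take⊂B , drop≡⊥ = min _ take⊂B , subst (Indep M) (sym drop≡⊥) (indep-∅ M)

    circuit-⊥++ : ∀ {C} → IsCircuit M C → IsCircuit (L ⊕ M) (⊥ ++ C)
    circuit-⊥++ {C} (dep , min) = dep ∘ proj₂ ∘ indep-++⁻ , minimal
      where
      minimal : ∀ D → D ⊂ ⊥ ++ C → Indep (L ⊕ M) D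
      minimal D D⊂ with ++⊂⊥++ (subst (_⊂ ⊥ ++ C) (sym (take++drop≡id a D)) D⊂)
      ... | take≡⊥ , drop⊂C = subst (Indep L) (sym take≡⊥) (indep-∅ L) , min _ drop⊂C

    circuit-++⊥⁻ : ∀ {B} → IsCircuit (L ⊕ M) (B ++ ⊥) → IsCircuit L B
    circuit-++⊥⁻ (dep , min) = (λ iB → dep (indep-++ iB (indep-∅ M))) , λ D D⊂B → proj₁ (indep-++⁻ (min _ (++-⊂ˡ D⊂B)))

    circuit-⊥++⁻ : ∀ {C} → IsCircuit (L ⊕ M) (⊥ ++ C) → IsCircuit M C
    circuit-⊥++⁻ (dep , min) = (λ iC → dep (indep-++ (indep-∅ L) iC)) , λ D D⊂C → proj₂ (indep-++⁻ (min _ (++-⊂ʳ D⊂C)))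

    -- A circuit meeting both summands would properly contain its two halves, which are then independent.
    circuit-⊕ : ∀ {C} → IsCircuit (L ⊕ M) C →
                (∃ λ B → IsCircuit L B × C ≡ B ++ ⊥) ⊎ (∃ λ D → IsCircuit M D × C ≡ ⊥ ++ D)
    circuit-⊕ {C} circ@(dep , min) with nonempty? (take a C) | nonempty? (drop a C)
    ... | _ | no empty = inj₁ (take a C , circuit-++⊥⁻ (subst (IsCircuit (L ⊕ M)) C≡ circ) , C≡)
      where
      C≡ : C ≡ take a C ++ ⊥
      C≡ = trans (sym (take++drop≡id a C)) (cong (take a C ++_) (Empty-unique empty))
    ... | no empty | yes _ = inj₂ (drop a C , circuit-⊥++⁻ (subst (IsCircuit (L ⊕ M)) C≡ circ) , C≡)
      where
      C≡ : C ≡ ⊥ ++ drop a C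
      C≡ = trans (sym (take++drop≡id a C)) (cong (_++ drop a C) (Empty-unique empty))
    ... | yes ne-take | yes ne-drop = contradiction (indep-++ indep-take indep-drop) dep′
      where
      C≡ : C ≡ take a C ++ drop a C
      C≡ = sym (take++drop≡id a C)
      dep′ : ¬ Indep (L ⊕ M) (take a C ++ drop a C)
      dep′ = dep ∘ subst (Indep (L ⊕ M)) (sym C≡)
      take⊂ : take a C ++ ⊥ ⊂ C
      take⊂ = subst (take a C ++ ⊥ ⊂_) (sym C≡) (++-⊂ʳ {B = take a C} (⊥⊂ ne-drop))
      drop⊂ : ⊥ ++ drop a C ⊂ C
      drop⊂ = subst (⊥ ++ drop a C ⊂_) (sym C≡) (++-⊂ˡ {C = drop a C} (⊥⊂ ne-take))
      indep-take : Indep L (take a C)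
      indep-take = proj₁ (indep-++⁻ {C = ⊥} (min _ take⊂))
      indep-drop : Indep M (drop a C)
      indep-drop = proj₂ (indep-++⁻ {B = ⊥} (min _ drop⊂))

  -- Coloops

  Coloop : ∀ {n} → Matroid n → Fin n → Set
  Coloop M x = ∀ S → Indep M S → Indep M (S ∪ ⁅ x ⁆)

  module _ {a n : ℕ} (L : Matroid a) (M : Matroid n) where
    open DirectSum L M

    coloop-↑ˡ : ∀ {q} → Coloop L q → Coloop (L ⊕ M) (q ↑ˡ n)
    coloop-↑ˡ {q} col S (iL , iM) = insertˡ q (col _ iL) iM

    coloop-↑ʳ : ∀ {y} → Coloop M y → Coloop (L ⊕ M) (a ↑ʳ y)
    coloop-↑ʳ {y} col S (iL , iM) = insertʳ y iL (col _ iM)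

    coloop-↑ˡ⁻ : ∀ {q} → Coloop (L ⊕ M) (q ↑ˡ n) → Coloop L q
    coloop-↑ˡ⁻ {q} col S iS = subst (λ B → Indep L (B ∪ ⁅ q ⁆)) (take-++ a S ⊥)
      (insertˡ⁻ q (col (S ++ ⊥) (indep-++ L M iS (indep-∅ M))))

    coloop-↑ʳ⁻ : ∀ {y} → Coloop (L ⊕ M) (a ↑ʳ y) → Coloop M y
    coloop-↑ʳ⁻ {y} col S iS = subst (λ C → Indep M (C ∪ ⁅ y ⁆)) (drop-++ a ⊥ S)
      (insertʳ⁻ y (col (⊥ ++ S) (indep-++ L M (indep-∅ L) iS)))

  lookup-ext : ∀ {n} {u w : Subset n} → (∀ i → lookup u i ≡ lookup w i) → u ≡ w
  lookup-ext {u = u} {w} eq = trans (sym (tabulate∘lookup u)) (trans (tabulate-cong eq) (tabulate∘lookup w))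

  T-lookup⇔∈ : ∀ {n} {p : Subset n} {i} → T (lookup p i) ⇔ i ∈ p
  T-lookup⇔∈ {p = p} {i} = mk⇔ (lookup⇒[]= i p ∘ Equivalence.to T-≡) (Equivalence.from T-≡ ∘ []=⇒lookup)

  module _ {n n′ : ℕ} (σ : Fin n ↔ Fin n′) where
    open Inverse σ

    lookup-⁅⁆-from : ∀ x z → lookup ⁅ x ⁆ (from z) ≡ lookup ⁅ to x ⁆ z
    lookup-⁅⁆-from x z = does-⇔ (mk⇔ ⇒ ⇐) (T? _) (T? _)
      where
      ⇒ : T (lookup ⁅ x ⁆ (from z)) → T (lookup ⁅ to x ⁆ z)
      ⇒ t = Equivalence.from T-lookup⇔∈ (Equivalence.from x∈⁅y⁆⇔x≡y
              (sym (inverseˡ (sym (Equivalence.to x∈⁅y⁆⇔x≡y (Equivalence.to T-lookup⇔∈ t))))))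
      ⇐ : T (lookup ⁅ to x ⁆ z) → T (lookup ⁅ x ⁆ (from z))
      ⇐ t = Equivalence.from T-lookup⇔∈ (Equivalence.from x∈⁅y⁆⇔x≡y
              (inverseʳ (Equivalence.to x∈⁅y⁆⇔x≡y (Equivalence.to T-lookup⇔∈ t))))

    image-∪⁅⁆ : ∀ (S : Subset n) x → image σ (S ∪ ⁅ x ⁆) ≡ image σ S ∪ ⁅ to x ⁆
    image-∪⁅⁆ S x = lookup-ext λ z → begin
      lookup (image σ (S ∪ ⁅ x ⁆)) z               ≡⟨ lookup∘tabulate _ z ⟩
      lookup (S ∪ ⁅ x ⁆) (from z)                   ≡⟨ lookup-zipWith _∨_ (from z) S ⁅ x ⁆ ⟩
      lookup S (from z) ∨ lookup ⁅ x ⁆ (from z)     ≡⟨ cong₂ _∨_ (sym (lookup∘tabulate _ z)) (lookup-⁅⁆-from x z) ⟩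
      lookup (image σ S) z ∨ lookup ⁅ to x ⁆ z      ≡⟨ lookup-zipWith _∨_ z (image σ S) ⁅ to x ⁆ ⟨
      lookup (image σ S ∪ ⁅ to x ⁆) z               ∎
      where open ≡-Reasoning

    to-injective : Injective _≡_ _≡_ to
    to-injective {x} {x′} eq = trans (sym (strictlyInverseʳ x)) (trans (cong from eq) (strictlyInverseʳ x′))

    from-injective : Injective _≡_ _≡_ from
    from-injective {y} {y′} eq = trans (sym (strictlyInverseˡ y)) (trans (cong to eq) (strictlyInverseˡ y′))

    preimage : Subset n′ → Subset n
    preimage T = tabulate (lookup T ∘ to)

    image-preimage : ∀ T → image σ (preimage T) ≡ T
    image-preimage T = lookup-ext λ z →
      trans (lookup∘tabulate _ z) (trans (lookup∘tabulate _ (from z)) (cong (lookup T) (strictlyInverseˡ z)))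

  module _ {n n′ : ℕ} (M : Matroid n) (M′ : Matroid n′) (iso : M ≅M M′) where
    private
      σ = proj₁ iso
      preserves = proj₂ iso
    open Inverse σ

    coloop-to : ∀ {x} → Coloop M x → Coloop M′ (to x)
    coloop-to {x} col T iT = subst (Indep M′) (trans (image-∪⁅⁆ σ (preimage σ T) x) (cong (_∪ ⁅ to x ⁆) (image-preimage σ T)))
      (proj₁ (preserves _) (col _ (proj₂ (preserves (preimage σ T)) (subst (Indep M′) (sym (image-preimage σ T)) iT))))

    coloop-from : ∀ {y} → Coloop M′ y → Coloop M (from y)
    coloop-from {y} col S iS = proj₂ (preserves (S ∪ ⁅ from y ⁆))
      (subst (Indep M′) (sym (trans (image-∪⁅⁆ σ S (from y)) (cong (λ z → image σ S ∪ ⁅ z ⁆) (strictlyInverseˡ y))))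
        (col _ (proj₁ (preserves S) iS)))

  record ColoopEnumeration {n} (M : Matroid n) (k : ℕ) : Set where
    field
      coloop           : Fin k → Fin n
      coloop-injective : Injective _≡_ _≡_ coloop
      isColoop         : ∀ r → Coloop M (coloop r)
      enumerates       : ∀ x → Coloop M x → ∃ λ r → coloop r ≡ x

  open ColoopEnumeration

  ≅M⇒#coloops≡ : ∀ {n n′ k k′} {M : Matroid n} {M′ : Matroid n′} → M ≅M M′ →
                 ColoopEnumeration M k → ColoopEnumeration M′ k′ → k ≡ k′
  ≅M⇒#coloops≡ {k = k} {k′} {M} {M′} iso E E′ = cantor-schröder-bernstein {f = index-to} {g = index-from} index-to-injective index-from-injective
    where
    open Inverse (proj₁ iso)
    index-to′ : ∀ r → ∃ λ r′ → coloop E′ r′ ≡ to (coloop E r)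
    index-to′ r = enumerates E′ (to (coloop E r)) (coloop-to M M′ iso (isColoop E r))
    index-from′ : ∀ r′ → ∃ λ r → coloop E r ≡ from (coloop E′ r′)
    index-from′ r′ = enumerates E (from (coloop E′ r′)) (coloop-from M M′ iso (isColoop E′ r′))
    index-to : Fin k → Fin k′
    index-to = proj₁ ∘ index-to′
    index-from : Fin k′ → Fin k
    index-from = proj₁ ∘ index-from′
    index-to-injective : Injective _≡_ _≡_ index-to
    index-to-injective {r} {s} eq = coloop-injective E (to-injective (proj₁ iso)
      (trans (sym (proj₂ (index-to′ r))) (trans (cong (coloop E′) eq) (proj₂ (index-to′ s)))))
    index-from-injective : Injective _≡_ _≡_ index-from
    index-from-injective {r} {s} eq = coloop-injective E′ (from-injective (proj₁ iso)
      (trans (sym (proj₂ (index-from′ r))) (trans (cong (coloop E) eq) (proj₂ (index-from′ s)))))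

  coloops-⊕ : ∀ {a n k k′} {L : Matroid a} {M : Matroid n} →
              ColoopEnumeration L k → ColoopEnumeration M k′ → ColoopEnumeration (L ⊕ M) (k + k′)
  coloops-⊕ {a} {n} {k} {k′} {L} {M} EL EM = record
    { coloop           = c
    ; coloop-injective = c-injective
    ; isColoop         = c-isColoop
    ; enumerates       = c-enumerates
    }
    where
    c : Fin (k + k′) → Fin (a + n)
    c = join a n ∘ Sum.map (coloop EL) (coloop EM) ∘ splitAt k

    c-↑ˡ : ∀ r → c (r ↑ˡ k′) ≡ coloop EL r ↑ˡ n
    c-↑ˡ r = cong (join a n ∘ Sum.map (coloop EL) (coloop EM)) (splitAt-↑ˡ k r k′)

    c-↑ʳ : ∀ r → c (k ↑ʳ r) ≡ a ↑ʳ coloop EM r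
    c-↑ʳ r = cong (join a n ∘ Sum.map (coloop EL) (coloop EM)) (splitAt-↑ʳ k k′ r)

    c-injective : Injective _≡_ _≡_ c
    c-injective {r} {s} eq with sumView k r | sumView k s
    ... | inl q | inl q′ = cong (_↑ˡ k′) (coloop-injective EL (↑ˡ-injective n _ _ (trans (sym (c-↑ˡ q)) (trans eq (c-↑ˡ q′)))))
    ... | inl q | inr y′ = contradiction (trans (sym (c-↑ˡ q)) (trans eq (c-↑ʳ y′))) (↑ˡ≢↑ʳ _ _)
    ... | inr y | inl q′ = contradiction (trans (sym (c-↑ˡ q′)) (trans (sym eq) (c-↑ʳ y))) (↑ˡ≢↑ʳ _ _)
    ... | inr y | inr y′ = cong (k ↑ʳ_) (coloop-injective EM (↑ʳ-injective a _ _ (trans (sym (c-↑ʳ y)) (trans eq (c-↑ʳ y′)))))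

    c-isColoop : ∀ r → Coloop (L ⊕ M) (c r)
    c-isColoop r with sumView k r
    ... | inl q = subst (Coloop (L ⊕ M)) (sym (c-↑ˡ q)) (coloop-↑ˡ L M (isColoop EL q))
    ... | inr y = subst (Coloop (L ⊕ M)) (sym (c-↑ʳ y)) (coloop-↑ʳ L M (isColoop EM y))

    c-enumerates : ∀ x → Coloop (L ⊕ M) x → ∃ λ r → c r ≡ x
    c-enumerates x col with sumView a x
    ... | inl q = let r , e = enumerates EL q (coloop-↑ˡ⁻ L M col) in r ↑ˡ k′ , trans (c-↑ˡ r) (cong (_↑ˡ n) e)
    ... | inr y = let r , e = enumerates EM y (coloop-↑ʳ⁻ L M col) in k ↑ʳ r , trans (c-↑ʳ r) (cong (a ↑ʳ_) e)

  -- Matroids given by a list of circuits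

  allSubsets? : ∀ {n p} {P : Pred (Subset n) p} → Decidable P → Dec (∀ A → P A)
  allSubsets? {zero}  P? = map′ (λ { p [] → p }) (λ h → h []) (P? [])
  allSubsets? {suc n} P? = map′ (λ { (pᵢ , pₒ) (inside ∷ A) → pᵢ A ; (pᵢ , pₒ) (outside ∷ A) → pₒ A })
    (λ h → (λ A → h (inside ∷ A)) , (λ A → h (outside ∷ A)))
    (allSubsets? (P? ∘ (inside ∷_)) ×-dec allSubsets? (P? ∘ (outside ∷_)))

  Exchange : ∀ {n} → (Subset n → Set) → Set
  Exchange {n} I = ∀ (A B : Subset n) → I A → I B → ∣ A ∣ < ∣ B ∣ → ∃ λ x → x ∈ B × x ∉ A × I (A ∪ ⁅ x ⁆)

  exchange? : ∀ {n} {I : Subset n → Set} → Decidable I → Dec (Exchange I)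
  exchange? I? = allSubsets? λ A → allSubsets? λ B → I? A →-dec (I? B →-dec ((∣ A ∣ <? ∣ B ∣) →-dec
    any? (λ x → (x ∈? B) ×-dec (¬? (x ∈? A) ×-dec I? (A ∪ ⁅ x ⁆)))))

  Avoids : ∀ {n} → List (Subset n) → Subset n → Set
  Avoids Cs A = ¬ Any (_⊆ A) Cs

  avoids? : ∀ {n} (Cs : List (Subset n)) → Decidable (Avoids Cs)
  avoids? Cs A = ¬? (anyᴸ? (_⊆? A) Cs)

  Antichain : ∀ {n} → List (Subset n) → Set
  Antichain Cs = All (λ C → All (λ C′ → ¬ C′ ⊂ C) Cs) Cs

  antichain? : ∀ {n} (Cs : List (Subset n)) → Dec (Antichain Cs)
  antichain? Cs = allᴬ? (λ C → allᴬ? (λ C′ → ¬? (C′ ⊂? C)) Cs) Cs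

  circuitMatroid : ∀ {n} (Cs : List (Subset n)) → Avoids Cs ⊥ → Exchange (Avoids Cs) → Matroid n
  circuitMatroid Cs avoids-⊥ exchange = record
    { Indep      = Avoids Cs
    ; indep-∅    = avoids-⊥
    ; indep-⊆    = λ {A} {B} B⊆A avoids-A → avoids-A ∘ mapᴬ {P = _⊆ B} {Q = _⊆ A} (λ C⊆B → ⊆-trans C⊆B B⊆A)
    ; indep-exch = λ {A} {B} → exchange A B
    }

  module _ {n} {Cs : List (Subset n)} {avoids-⊥ : Avoids Cs ⊥} {exchange : Exchange (Avoids Cs)} where
    private M = circuitMatroid Cs avoids-⊥ exchange

    circuit⇒listed : ∀ {C} → IsCircuit M C → C ∈ᴸ Cs
    circuit⇒listed {C} (dep , min) with find (decidable-stable (anyᴸ? (_⊆? C) Cs) dep)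
    ... | C₀ , C₀∈Cs , C₀⊆C = subst (_∈ᴸ Cs) (⊆-antisym C₀⊆C C⊆C₀) C₀∈Cs
      where
      C⊆C₀ : C ⊆ C₀
      C⊆C₀ {x} x∈C = decidable-stable (x ∈? C₀) λ x∉C₀ → min C₀ (C₀⊆C , x , x∈C , x∉C₀) (lose C₀∈Cs ⊆-refl)

    listed⇒circuit : ∀ {C} → Antichain Cs → C ∈ᴸ Cs → IsCircuit M C
    listed⇒circuit antichain C∈Cs = (λ avoids → avoids (lose C∈Cs ⊆-refl)) , minimal
      where
      minimal : ∀ D → D ⊂ _ → Avoids Cs D
      minimal D D⊂C contains with find contains
      ... | C′ , C′∈Cs , C′⊆D = lookupᴬ (lookupᴬ antichain C∈Cs) C′∈Cs (⊆-⊂-trans C′⊆D D⊂C)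

  -- Skew and meeting blocks

  data Block : Set where
    skew meeting : Block

  line₀₁₂ line₃₄₅ line₀₃₄ circuit₁₂₃₄ : Subset 6
  line₀₁₂     = inside  ∷ inside  ∷ inside  ∷ outside ∷ outside ∷ outside ∷ []
  line₃₄₅     = outside ∷ outside ∷ outside ∷ inside  ∷ inside  ∷ inside  ∷ []
  line₀₃₄     = inside  ∷ outside ∷ outside ∷ inside  ∷ inside  ∷ outside ∷ []
  circuit₁₂₃₄ = outside ∷ inside  ∷ inside  ∷ inside  ∷ inside  ∷ outside ∷ []

  circuits : Block → List (Subset 6)
  circuits skew    = line₀₁₂ ∷ line₃₄₅ ∷ []
  circuits meeting = line₀₁₂ ∷ line₀₃₄ ∷ circuit₁₂₃₄ ∷ []

  block-avoids-⊥ : ∀ b → Avoids (circuits b) ⊥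
  block-avoids-⊥ skew    = from-yes (avoids? (circuits skew) ⊥)
  block-avoids-⊥ meeting = from-yes (avoids? (circuits meeting) ⊥)

  block-exchange : ∀ b → Exchange (Avoids (circuits b))
  block-exchange skew    = from-yes (exchange? (avoids? (circuits skew)))
  block-exchange meeting = from-yes (exchange? (avoids? (circuits meeting)))

  block : Block → Matroid 6
  block b = circuitMatroid (circuits b) (block-avoids-⊥ b) (block-exchange b)

  block-antichain : ∀ b → Antichain (circuits b)
  block-antichain skew    = from-yes (antichain? (circuits skew))
  block-antichain meeting = from-yes (antichain? (circuits meeting))

  block-circuit : ∀ b {C} → C ∈ᴸ circuits b → IsCircuit (block b) C
  block-circuit b = listed⇒circuit {avoids-⊥ = block-avoids-⊥ b} {block-exchange b} (block-antichain b)

  block-circuit⁻ : ∀ b {C} → IsCircuit (block b) C → C ∈ᴸ circuits b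
  block-circuit⁻ b = circuit⇒listed {avoids-⊥ = block-avoids-⊥ b} {block-exchange b}

  block-simple : ∀ b → Simple (block b)
  block-simple skew    = from-yes (allSubsets? λ A → (∣ A ∣ ≤? 2) →-dec avoids? (circuits skew) A)
  block-simple meeting = from-yes (allSubsets? λ A → (∣ A ∣ ≤? 2) →-dec avoids? (circuits meeting) A)

  coloop? : ∀ b x → Dec (Coloop (block b) x)
  coloop? b x = allSubsets? λ S → avoids? (circuits b) S →-dec avoids? (circuits b) (S ∪ ⁅ x ⁆)

  coloopCount : Block → ℕ
  coloopCount skew    = 0
  coloopCount meeting = 1

  block-coloops : ∀ b → ColoopEnumeration (block b) (coloopCount b)
  block-coloops skew = record
    { coloop           = λ ()
    ; coloop-injective = λ { {()} }
    ; isColoop         = λ ()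
    ; enumerates       = λ x col → contradiction col (from-yes (all? (¬? ∘ coloop? skew)) x)
    }
  block-coloops meeting = record
    { coloop           = λ _ → 5F
    ; coloop-injective = λ { {zero} {zero} _ → refl }
    ; isColoop         = λ _ → from-yes (coloop? meeting 5F)
    ; enumerates       = λ x col → zero , sym (from-yes (all? λ x → coloop? meeting x →-dec (x ≟ᶠ 5F)) x col)
    }

  emptyMatroid : Matroid 0
  emptyMatroid = record
    { Indep      = λ _ → ⊤
    ; indep-∅    = tt
    ; indep-⊆    = λ _ _ → tt
    ; indep-exch = λ { {[]} {[]} _ _ () }
    }

  emptyMatroid-coloops : ColoopEnumeration emptyMatroid 0
  emptyMatroid-coloops = record { coloop = λ () ; coloop-injective = λ { {()} } ; isColoop = λ () ; enumerates = λ () }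

  blockSum : ∀ {k} → Vec Block k → Matroid (k * 6)
  blockSum []       = emptyMatroid
  blockSum (b ∷ bs) = block b ⊕ blockSum bs

  #coloops : ∀ {k} → Vec Block k → ℕ
  #coloops = sum ∘ map coloopCount

  blockSum-simple : ∀ {k} (bs : Vec Block k) → Simple (blockSum bs)
  blockSum-simple []       _ _ = tt
  blockSum-simple (b ∷ bs)     = simple-⊕ (block b) (blockSum bs) (block-simple b) (blockSum-simple bs)

  blockSum-coloops : ∀ {k} (bs : Vec Block k) → ColoopEnumeration (blockSum bs) (#coloops bs)
  blockSum-coloops []       = emptyMatroid-coloops
  blockSum-coloops (b ∷ bs) = coloops-⊕ (block-coloops b) (blockSum-coloops bs)

  blockSum-≇ : ∀ {k} (bs bs′ : Vec Block k) → #coloops bs ≢ #coloops bs′ → ¬ (blockSum bs ≅M blockSum bs′)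
  blockSum-≇ bs bs′ ≢ iso = ≢ (≅M⇒#coloops≡ iso (blockSum-coloops bs) (blockSum-coloops bs′))

  meetingThenSkew : ℕ → (k : ℕ) → Vec Block k
  meetingThenSkew _       zero    = []
  meetingThenSkew zero    (suc k) = skew ∷ meetingThenSkew zero k
  meetingThenSkew (suc j) (suc k) = meeting ∷ meetingThenSkew j k

  #coloops-meetingThenSkew : ∀ {j k} → j ≤ k → #coloops (meetingThenSkew j k) ≡ j
  #coloops-meetingThenSkew {zero}  {zero}  _         = refl
  #coloops-meetingThenSkew {zero}  {suc k} _         = #coloops-meetingThenSkew {zero} {k} z≤n
  #coloops-meetingThenSkew {suc j} {suc k} (s≤s j≤k) = cong suc (#coloops-meetingThenSkew j≤k)

open Matroids

module ExteriorAlgebra {c ℓ} (K : CommutativeRing c ℓ) where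

  open import Algebra.Structures using (IsAbelianGroup)
  import Algebra.Construct.Pointwise as Pointwise
  import Algebra.Properties.Ring as RingProperties
  import Algebra.Properties.CommutativeSemigroup as CommutativeSemigroupProperties
  open import Data.Fin using (Fin; zero; suc; _↑ʳ_)
  open import Data.Fin.Subset using (Subset; inside; outside; ∣_∣; ⁅_⁆; ⊥)
  open import Data.List using (List; []; _∷_; _++_; map)
  import Data.List.Properties as List
  open import Data.Nat using (ℕ; zero; suc) renaming (_+_ to _+ℕ_)
  open import Data.Nat.Properties using (+-suc; suc-injective) renaming (_≟_ to _≟ℕ_)
  open import Data.Product using (_,_)
  open import Data.Vec using ([]; _∷_)
  open import Function using (_∘′_)
  open import Relation.Binary.Bundles using (Setoid)
  import Relation.Binary.PropositionalEquality as ≡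
  open import Relation.Nullary using (yes; no; contradiction)
  open import Relation.Binary.PropositionalEquality using (_≢_)
  import Relation.Binary.Reasoning.Setoid as SetoidReasoning

  open CommutativeRing K renaming (Carrier to R) hiding (zero)
  open RingProperties ring using (-‿distribˡ-*; -‿distribʳ-*; -0#≈0#; -‿+-comm)
  open CommutativeSemigroupProperties +-commutativeSemigroup using (interchange)
  private module KR = SetoidReasoning setoid
  open OS K public

  module _ {a} {A : Set a} where

    sumL-cong : ∀ (xs : List A) {f g : A → R} → (∀ x → f x ≈ g x) → sumL (map f xs) ≈ sumL (map g xs)
    sumL-cong []       f≈g = refl
    sumL-cong (x ∷ xs) f≈g = +-cong (f≈g x) (sumL-cong xs f≈g)

    sumL-0 : ∀ (xs : List A) {f : A → R} → (∀ x → f x ≈ 0#) → sumL (map f xs) ≈ 0#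
    sumL-0 []       f≈0 = refl
    sumL-0 (x ∷ xs) f≈0 = trans (+-cong (f≈0 x) (sumL-0 xs f≈0)) (+-identityˡ 0#)

    sumL-+ : ∀ (xs : List A) (f g : A → R) → sumL (map (λ x → f x + g x) xs) ≈ sumL (map f xs) + sumL (map g xs)
    sumL-+ []       f g = sym (+-identityˡ 0#)
    sumL-+ (x ∷ xs) f g = trans (+-congˡ (sumL-+ xs f g)) (interchange (f x) (g x) _ _)

    sumL-* : ∀ (xs : List A) (k : R) (f : A → R) → sumL (map (λ x → k * f x) xs) ≈ k * sumL (map f xs)
    sumL-* []       k f = sym (zeroʳ k)
    sumL-* (x ∷ xs) k f = trans (+-congˡ (sumL-* xs k f)) (sym (distribˡ k _ _))

    sumL-neg : ∀ (xs : List A) (f : A → R) → sumL (map (λ x → - f x) xs) ≈ - sumL (map f xs)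
    sumL-neg []       f = sym -0#≈0#
    sumL-neg (x ∷ xs) f = trans (+-congˡ (sumL-neg xs f)) (-‿+-comm _ _)

  sumL-++ : ∀ xs ys → sumL (xs ++ ys) ≈ sumL xs + sumL ys
  sumL-++ []       ys = sym (+-identityˡ _)
  sumL-++ (x ∷ xs) ys = trans (+-congˡ (sumL-++ xs ys)) (sym (+-assoc _ _ _))

  sumSubsets : ∀ n → (Subset n → R) → R
  sumSubsets n f = sumL (map f (allSubsets n))

  sumSubsets-split : ∀ n (f : Subset (suc n) → R) →
                     sumSubsets (suc n) f ≈ sumSubsets n (f ∘′ (inside ∷_)) + sumSubsets n (f ∘′ (outside ∷_))
  sumSubsets-split n f = KR.begin
    sumL (map f (map (inside ∷_) Ss ++ map (outside ∷_) Ss))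
      KR.≡⟨ ≡.cong sumL (List.map-++ f (map (inside ∷_) Ss) _) ⟩
    sumL (map f (map (inside ∷_) Ss) ++ map f (map (outside ∷_) Ss))
      KR.≈⟨ sumL-++ (map f (map (inside ∷_) Ss)) _ ⟩
    sumL (map f (map (inside ∷_) Ss)) + sumL (map f (map (outside ∷_) Ss))
      KR.≡⟨ ≡.cong₂ _+_ (≡.cong sumL (≡.sym (List.map-∘ Ss))) (≡.cong sumL (≡.sym (List.map-∘ Ss))) ⟩
    sumSubsets n (f ∘′ (inside ∷_)) + sumSubsets n (f ∘′ (outside ∷_)) KR.∎
    where Ss = allSubsets n

  sumSubsets-outside : ∀ n (f : Subset (suc n) → R) → (∀ S → f (inside ∷ S) ≈ 0#) →
                       sumSubsets (suc n) f ≈ sumSubsets n (f ∘′ (outside ∷_))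
  sumSubsets-outside n f f≈0 =
    trans (sumSubsets-split n f) (trans (+-congʳ (sumL-0 (allSubsets n) f≈0)) (+-identityˡ _))

  sumSubsets-inside : ∀ n (f : Subset (suc n) → R) → (∀ S → f (outside ∷ S) ≈ 0#) →
                      sumSubsets (suc n) f ≈ sumSubsets n (f ∘′ (inside ∷_))
  sumSubsets-inside n f f≈0 =
    trans (sumSubsets-split n f) (trans (+-congˡ (sumL-0 (allSubsets n) f≈0)) (+-identityʳ _))

  infix 4 _≋_
  _≋_ : ∀ {n} → Λ n → Λ n → Set ℓ
  x ≋ y = ∀ U → x U ≈ y U

  0Λ : ∀ {n} → Λ n
  0Λ _ = 0#

  +Λ-isAbelianGroup : ∀ {n} → IsAbelianGroup (_≋_ {n}) _+Λ_ 0Λ -Λ_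
  +Λ-isAbelianGroup {n} = Pointwise.isAbelianGroup (Subset n) +-isAbelianGroup

  ≋-setoid : ℕ → Setoid c ℓ
  ≋-setoid n = record { isEquivalence = IsAbelianGroup.isEquivalence (+Λ-isAbelianGroup {n}) }

  module ≋-Reasoning {n : ℕ} = SetoidReasoning (≋-setoid n)

  module _ {n : ℕ} where
    open Setoid (≋-setoid n) public using () renaming (refl to ≋-refl; reflexive to ≋-reflexive; sym to ≋-sym; trans to ≋-trans)
    private Ss = allSubsets n

    +Λ-cong : ∀ {x x′ y y′ : Λ n} → x ≋ x′ → y ≋ y′ → x +Λ y ≋ x′ +Λ y′
    +Λ-cong p q U = +-cong (p U) (q U)

    -Λ-cong : ∀ {x x′ : Λ n} → x ≋ x′ → -Λ x ≋ -Λ x′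
    -Λ-cong p U = -‿cong (p U)

    +Λ-assoc : ∀ (x y z : Λ n) → (x +Λ y) +Λ z ≋ x +Λ (y +Λ z)
    +Λ-assoc x y z U = +-assoc _ _ _

    +Λ-identityˡ : ∀ (x : Λ n) → 0Λ +Λ x ≋ x
    +Λ-identityˡ x U = +-identityˡ _

    +Λ-identityʳ : ∀ (x : Λ n) → x +Λ 0Λ ≋ x
    +Λ-identityʳ x U = +-identityʳ _

    -Λ-+ : ∀ (x y : Λ n) → -Λ (x +Λ y) ≋ (-Λ x) +Λ (-Λ y)
    -Λ-+ x y U = sym (-‿+-comm _ _)

    *Λ-cong : ∀ {x x′ y y′ : Λ n} → x ≋ x′ → y ≋ y′ → x *Λ y ≋ x′ *Λ y′
    *Λ-cong p q U = sumL-cong Ss λ S → sumL-cong Ss λ T → *-congʳ (*-cong (p S) (q T))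

    *Λ-distribˡ : ∀ (x y z : Λ n) → x *Λ (y +Λ z) ≋ (x *Λ y) +Λ (x *Λ z)
    *Λ-distribˡ x y z U = trans (sumL-cong Ss λ S → trans (sumL-cong Ss λ T →
        trans (*-congʳ (distribˡ (x S) (y T) (z T))) (distribʳ (coef S T U) _ _))
        (sumL-+ Ss _ _)) (sumL-+ Ss _ _)

    *Λ-distribʳ : ∀ (x y z : Λ n) → (y +Λ z) *Λ x ≋ (y *Λ x) +Λ (z *Λ x)
    *Λ-distribʳ x y z U = trans (sumL-cong Ss λ S → trans (sumL-cong Ss λ T →
        trans (*-congʳ (distribʳ (x T) (y S) (z S))) (distribʳ (coef S T U) _ _))
        (sumL-+ Ss _ _)) (sumL-+ Ss _ _)

    ·Λ-*Λˡ : ∀ (a : R) (x y : Λ n) → (a ·Λ x) *Λ y ≋ a ·Λ (x *Λ y)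
    ·Λ-*Λˡ a x y U = trans (sumL-cong Ss λ S → trans (sumL-cong Ss λ T →
        trans (*-congʳ (*-assoc a (x S) (y T))) (*-assoc a _ _))
        (sumL-* Ss a _)) (sumL-* Ss a _)

    ·Λ-*Λʳ : ∀ (a : R) (x y : Λ n) → x *Λ (a ·Λ y) ≋ a ·Λ (x *Λ y)
    ·Λ-*Λʳ a x y U = trans (sumL-cong Ss λ S → trans (sumL-cong Ss λ T →
        trans (*-congʳ (swap (x S) (y T))) (*-assoc a _ _))
        (sumL-* Ss a _)) (sumL-* Ss a _)
      where
      swap : ∀ p q → p * (a * q) ≈ a * (p * q)
      swap p q = trans (sym (*-assoc p a q)) (trans (*-congʳ (*-comm p a)) (*-assoc a p q))

    -Λ-*Λˡ : ∀ (x y : Λ n) → (-Λ x) *Λ y ≋ -Λ (x *Λ y)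
    -Λ-*Λˡ x y U = trans (sumL-cong Ss λ S → trans (sumL-cong Ss λ T →
        trans (*-congʳ (sym (-‿distribˡ-* (x S) (y T)))) (sym (-‿distribˡ-* _ _)))
        (sumL-neg Ss _)) (sumL-neg Ss _)

    -Λ-*Λʳ : ∀ (x y : Λ n) → x *Λ (-Λ y) ≋ -Λ (x *Λ y)
    -Λ-*Λʳ x y U = trans (sumL-cong Ss λ S → trans (sumL-cong Ss λ T →
        trans (*-congʳ (sym (-‿distribʳ-* (x S) (y T)))) (sym (-‿distribˡ-* _ _)))
        (sumL-neg Ss _)) (sumL-neg Ss _)

    *Λ-zeroˡ : ∀ (y : Λ n) → 0Λ *Λ y ≋ 0Λ
    *Λ-zeroˡ y U = sumL-0 Ss λ S → sumL-0 Ss λ T → trans (*-congʳ (zeroˡ _)) (zeroˡ _)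

    *Λ-zeroʳ : ∀ (x : Λ n) → x *Λ 0Λ ≋ 0Λ
    *Λ-zeroʳ x U = sumL-0 Ss λ S → sumL-0 Ss λ T → trans (*-congʳ (zeroʳ _)) (zeroˡ _)

  -- Every x : Λ (suc n) is free₀ x + e₀ ∧ div₀ x, where free₀ x and div₀ x live
  -- in the exterior algebra on the remaining n generators.
  free₀ div₀ : ∀ {n} → Λ (suc n) → Λ n
  free₀ x U = x (outside ∷ U)
  div₀  x U = x (inside ∷ U)

  ≋-by-parts : ∀ {n} {x y : Λ (suc n)} → free₀ x ≋ free₀ y → div₀ x ≋ div₀ y → x ≋ y
  ≋-by-parts p q (outside ∷ U) = p U
  ≋-by-parts p q (inside ∷ U)  = q U

  gradeInv : ∀ {n} → Λ n → Λ n
  gradeInv x U = signPow ∣ U ∣ * x U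

  *Λ-[] : (x y : Λ 0) → (x *Λ y) [] ≈ x [] * y []
  *Λ-[] x y = trans (+-identityʳ _) (trans (+-identityʳ _) (*-identityʳ _))

  free₀-*Λ : ∀ {n} (x y : Λ (suc n)) → free₀ (x *Λ y) ≋ free₀ x *Λ free₀ y
  free₀-*Λ {n} x y U = trans (sumSubsets-outside n _ no-e₀-in-x)
    (sumL-cong (allSubsets n) λ S → sumSubsets-outside n _ λ T → zeroʳ _)
    where
    no-e₀-in-x : ∀ S → sumSubsets (suc n) (λ T → x (inside ∷ S) * y T * coef (inside ∷ S) T (outside ∷ U)) ≈ 0#
    no-e₀-in-x S = sumL-0 (allSubsets (suc n)) λ
      { (inside ∷ T)  → zeroʳ _
      ; (outside ∷ T) → zeroʳ _ }

  div₀-*Λ : ∀ {n} (x y : Λ (suc n)) → div₀ (x *Λ y) ≋ (div₀ x *Λ free₀ y) +Λ (gradeInv (free₀ x) *Λ div₀ y)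
  div₀-*Λ {n} x y U = trans (sumSubsets-split n _)
    (+-cong (sumL-cong (allSubsets n) λ S → sumSubsets-outside n _ λ T → zeroʳ _)
            (sumL-cong (allSubsets n) λ S → trans (sumSubsets-inside n _ λ T → zeroʳ _)
              (sumL-cong (allSubsets n) λ T → move-sign _ _ _ _)))
    where
    move-sign : ∀ a b s k → a * b * (s * k) ≈ (s * a) * b * k
    move-sign a b s k = KR.begin
      a * b * (s * k) KR.≈⟨ *-assoc (a * b) s k ⟨
      a * b * s * k   KR.≈⟨ *-congʳ (*-comm (a * b) s) ⟩
      s * (a * b) * k KR.≈⟨ *-congʳ (*-assoc s a b) ⟨
      s * a * b * k   KR.∎

  module _ {n : ℕ} where

    gradeInv-cong : ∀ {x y : Λ n} → x ≋ y → gradeInv x ≋ gradeInv y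
    gradeInv-cong p U = *-congˡ (p U)

    gradeInv-+ : ∀ (x y : Λ n) → gradeInv (x +Λ y) ≋ gradeInv x +Λ gradeInv y
    gradeInv-+ x y U = distribˡ _ _ _

  div₀-gradeInv : ∀ {n} (x : Λ (suc n)) → div₀ (gradeInv x) ≋ -Λ gradeInv (div₀ x)
  div₀-gradeInv x U = sym (-‿distribˡ-* _ _)

  gradeInv-[] : (x : Λ 0) → gradeInv x ≋ x
  gradeInv-[] x [] = *-identityˡ _

  gradeInv-*Λ : ∀ {n} (x y : Λ n) → gradeInv (x *Λ y) ≋ gradeInv x *Λ gradeInv y
  gradeInv-*Λ {zero} x y [] = trans (*-identityˡ _) (trans (*Λ-[] x y)
    (trans (*-cong (sym (*-identityˡ _)) (sym (*-identityˡ _))) (sym (*Λ-[] (gradeInv x) (gradeInv y)))))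
  gradeInv-*Λ {suc n} x y = ≋-by-parts free-part div-part
    where
    open ≋-Reasoning
    free-part : free₀ (gradeInv (x *Λ y)) ≋ free₀ (gradeInv x *Λ gradeInv y)
    free-part = begin
      gradeInv (free₀ (x *Λ y))                  ≈⟨ gradeInv-cong (free₀-*Λ x y) ⟩
      gradeInv (free₀ x *Λ free₀ y)              ≈⟨ gradeInv-*Λ (free₀ x) (free₀ y) ⟩
      gradeInv (free₀ x) *Λ gradeInv (free₀ y)   ≈⟨ free₀-*Λ (gradeInv x) (gradeInv y) ⟨
      free₀ (gradeInv x *Λ gradeInv y)           ∎
    div-part : div₀ (gradeInv (x *Λ y)) ≋ div₀ (gradeInv x *Λ gradeInv y)
    div-part = begin
      div₀ (gradeInv (x *Λ y))
        ≈⟨ div₀-gradeInv (x *Λ y) ⟩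
      -Λ gradeInv (div₀ (x *Λ y))
        ≈⟨ -Λ-cong (gradeInv-cong (div₀-*Λ x y)) ⟩
      -Λ gradeInv ((div₀ x *Λ free₀ y) +Λ (gradeInv (free₀ x) *Λ div₀ y))
        ≈⟨ -Λ-cong (≋-trans (gradeInv-+ _ _) (+Λ-cong (gradeInv-*Λ _ _) (gradeInv-*Λ _ _))) ⟩
      -Λ ((gradeInv (div₀ x) *Λ gradeInv (free₀ y)) +Λ (gradeInv (gradeInv (free₀ x)) *Λ gradeInv (div₀ y)))
        ≈⟨ -Λ-+ _ _ ⟩
      (-Λ (gradeInv (div₀ x) *Λ gradeInv (free₀ y))) +Λ (-Λ (gradeInv (gradeInv (free₀ x)) *Λ gradeInv (div₀ y)))
        ≈⟨ +Λ-cong (-Λ-*Λˡ _ _) (-Λ-*Λʳ _ _) ⟨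
      ((-Λ gradeInv (div₀ x)) *Λ gradeInv (free₀ y)) +Λ (gradeInv (gradeInv (free₀ x)) *Λ (-Λ gradeInv (div₀ y)))
        ≈⟨ +Λ-cong (*Λ-cong (div₀-gradeInv x) ≋-refl) (*Λ-cong ≋-refl (div₀-gradeInv y)) ⟨
      (div₀ (gradeInv x) *Λ free₀ (gradeInv y)) +Λ (gradeInv (free₀ (gradeInv x)) *Λ div₀ (gradeInv y))
        ≈⟨ div₀-*Λ (gradeInv x) (gradeInv y) ⟨
      div₀ (gradeInv x *Λ gradeInv y) ∎

  *Λ-assoc : ∀ {n} (x y z : Λ n) → (x *Λ y) *Λ z ≋ x *Λ (y *Λ z)
  *Λ-assoc {zero} x y z [] = KR.begin
    ((x *Λ y) *Λ z) []   KR.≈⟨ *Λ-[] (x *Λ y) z ⟩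
    (x *Λ y) [] * z []   KR.≈⟨ *-congʳ (*Λ-[] x y) ⟩
    x [] * y [] * z []   KR.≈⟨ *-assoc _ _ _ ⟩
    x [] * (y [] * z []) KR.≈⟨ *-congˡ (*Λ-[] y z) ⟨
    x [] * (y *Λ z) []   KR.≈⟨ *Λ-[] x (y *Λ z) ⟨
    (x *Λ (y *Λ z)) []   KR.∎
  *Λ-assoc {suc n} x y z = ≋-by-parts free-part div-part
    where
    open ≋-Reasoning
    free-part : free₀ ((x *Λ y) *Λ z) ≋ free₀ (x *Λ (y *Λ z))
    free-part = begin
      free₀ ((x *Λ y) *Λ z)             ≈⟨ free₀-*Λ _ _ ⟩
      free₀ (x *Λ y) *Λ free₀ z         ≈⟨ *Λ-cong (free₀-*Λ x y) ≋-refl ⟩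
      (free₀ x *Λ free₀ y) *Λ free₀ z   ≈⟨ *Λ-assoc _ _ _ ⟩
      free₀ x *Λ (free₀ y *Λ free₀ z)   ≈⟨ *Λ-cong ≋-refl (free₀-*Λ y z) ⟨
      free₀ x *Λ free₀ (y *Λ z)         ≈⟨ free₀-*Λ _ _ ⟨
      free₀ (x *Λ (y *Λ z))             ∎
    a = div₀ x ; b = free₀ x ; p = div₀ y ; q = free₀ y ; s = div₀ z ; t = free₀ z
    div-part : div₀ ((x *Λ y) *Λ z) ≋ div₀ (x *Λ (y *Λ z))
    div-part = begin
      div₀ ((x *Λ y) *Λ z)
        ≈⟨ div₀-*Λ _ _ ⟩
      (div₀ (x *Λ y) *Λ t) +Λ (gradeInv (free₀ (x *Λ y)) *Λ s)
        ≈⟨ +Λ-cong (*Λ-cong (div₀-*Λ x y) ≋-refl) (*Λ-cong (≋-trans (gradeInv-cong (free₀-*Λ x y)) (gradeInv-*Λ b q)) ≋-refl) ⟩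
      (((a *Λ q) +Λ (gradeInv b *Λ p)) *Λ t) +Λ ((gradeInv b *Λ gradeInv q) *Λ s)
        ≈⟨ +Λ-cong (*Λ-distribʳ _ _ _) ≋-refl ⟩
      (((a *Λ q) *Λ t) +Λ ((gradeInv b *Λ p) *Λ t)) +Λ ((gradeInv b *Λ gradeInv q) *Λ s)
        ≈⟨ +Λ-cong (+Λ-cong (*Λ-assoc _ _ _) (*Λ-assoc _ _ _)) (*Λ-assoc _ _ _) ⟩
      ((a *Λ (q *Λ t)) +Λ (gradeInv b *Λ (p *Λ t))) +Λ (gradeInv b *Λ (gradeInv q *Λ s))
        ≈⟨ +Λ-assoc _ _ _ ⟩
      (a *Λ (q *Λ t)) +Λ ((gradeInv b *Λ (p *Λ t)) +Λ (gradeInv b *Λ (gradeInv q *Λ s)))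
        ≈⟨ +Λ-cong ≋-refl (*Λ-distribˡ _ _ _) ⟨
      (a *Λ (q *Λ t)) +Λ (gradeInv b *Λ ((p *Λ t) +Λ (gradeInv q *Λ s)))
        ≈⟨ +Λ-cong (*Λ-cong ≋-refl (free₀-*Λ y z)) (*Λ-cong ≋-refl (div₀-*Λ y z)) ⟨
      (a *Λ free₀ (y *Λ z)) +Λ (gradeInv b *Λ div₀ (y *Λ z))
        ≈⟨ div₀-*Λ _ _ ⟨
      div₀ (x *Λ (y *Λ z)) ∎

  gradeInv-1 : ∀ {n} → gradeInv (1Λ {n}) ≋ 1Λ
  gradeInv-1 {zero}  [] = *-identityˡ _
  gradeInv-1 {suc n} = ≋-by-parts gradeInv-1 λ U → zeroʳ _

  *Λ-identityˡ : ∀ {n} (x : Λ n) → 1Λ *Λ x ≋ x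
  *Λ-identityˡ {zero}  x [] = trans (*Λ-[] 1Λ x) (*-identityˡ _)
  *Λ-identityˡ {suc n} x = ≋-by-parts
    (≋-trans (free₀-*Λ 1Λ x) (*Λ-identityˡ _))
    (begin
      div₀ (1Λ *Λ x)                                   ≈⟨ div₀-*Λ _ _ ⟩
      (div₀ 1Λ *Λ free₀ x) +Λ (gradeInv 1Λ *Λ div₀ x)  ≈⟨ +Λ-cong (*Λ-zeroˡ _) (*Λ-cong gradeInv-1 ≋-refl) ⟩
      0Λ +Λ (1Λ *Λ div₀ x)                             ≈⟨ +Λ-identityˡ _ ⟩
      1Λ *Λ div₀ x                                     ≈⟨ *Λ-identityˡ _ ⟩
      div₀ x                                           ∎)
    where open ≋-Reasoning

  *Λ-identityʳ : ∀ {n} (x : Λ n) → x *Λ 1Λ ≋ x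
  *Λ-identityʳ {zero}  x [] = trans (*Λ-[] x 1Λ) (*-identityʳ _)
  *Λ-identityʳ {suc n} x = ≋-by-parts
    (≋-trans (free₀-*Λ x 1Λ) (*Λ-identityʳ _))
    (begin
      div₀ (x *Λ 1Λ)                                          ≈⟨ div₀-*Λ _ _ ⟩
      (div₀ x *Λ free₀ 1Λ) +Λ (gradeInv (free₀ x) *Λ div₀ 1Λ) ≈⟨ +Λ-cong (*Λ-identityʳ _) (*Λ-zeroʳ _) ⟩
      div₀ x +Λ 0Λ                                            ≈⟨ +Λ-identityʳ _ ⟩
      div₀ x                                                  ∎)
    where open ≋-Reasoning

  Λ-ring : ℕ → Ring c ℓ
  Λ-ring n = record
    { Carrier = Λ n
    ; _≈_     = _≋_
    ; _+_     = _+Λ_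
    ; _*_     = _*Λ_
    ; -_      = -Λ_
    ; 0#      = 0Λ
    ; 1#      = 1Λ
    ; isRing  = record
      { +-isAbelianGroup = +Λ-isAbelianGroup
      ; *-cong           = *Λ-cong
      ; *-assoc          = *Λ-assoc
      ; *-identity       = *Λ-identityˡ , *Λ-identityʳ
      ; distrib          = *Λ-distribˡ , *Λ-distribʳ
      }
    }

  module ΛR {n : ℕ} where
    open Ring (Λ-ring n) public
    open RingProperties (Λ-ring n) public

  infixl 6 _−_
  _−_ : ∀ {n} → Λ n → Λ n → Λ n
  x − y = x +Λ (-Λ y)

  −-cong : ∀ {n} {x x′ y y′ : Λ n} → x ≋ x′ → y ≋ y′ → x − y ≋ x′ − y′
  −-cong p q = +Λ-cong p (-Λ-cong q)

  module _ {n : ℕ} where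

    Homog-cong : ∀ {k} {x y : Λ n} → x ≋ y → Homog k x → Homog k y
    Homog-cong x≋y hx U ≢k = trans (sym (x≋y U)) (hx U ≢k)

    Homog-0 : ∀ {k} → Homog k (0Λ {n})
    Homog-0 U _ = refl

    Homog-+ : ∀ {k} {x y : Λ n} → Homog k x → Homog k y → Homog k (x +Λ y)
    Homog-+ hx hy U ≢k = trans (+-cong (hx U ≢k) (hy U ≢k)) (+-identityˡ _)

    Homog-neg : ∀ {k} {x : Λ n} → Homog k x → Homog k (-Λ x)
    Homog-neg hx U ≢k = trans (-‿cong (hx U ≢k)) -0#≈0#

    Homog-− : ∀ {k} {x y : Λ n} → Homog k x → Homog k y → Homog k (x − y)
    Homog-− hx hy = Homog-+ hx (Homog-neg hy)

    Homog-· : ∀ {k} a {x : Λ n} → Homog k x → Homog k (a ·Λ x)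
    Homog-· a hx U ≢k = trans (*-congˡ (hx U ≢k)) (zeroʳ _)

  Homog-1 : ∀ {n} → Homog 0 (1Λ {n})
  Homog-1 {zero}  []            ≢0 = contradiction ≡.refl ≢0
  Homog-1 {suc n} (inside ∷ U)  ≢0 = refl
  Homog-1 {suc n} (outside ∷ U) ≢0 = Homog-1 U ≢0

  coef-degree : ∀ {n} (S T U : Subset n) → ∣ U ∣ ≢ ∣ S ∣ +ℕ ∣ T ∣ → coef S T U ≈ 0#
  coef-degree []            []            []            ≢ = contradiction ≡.refl ≢
  coef-degree (inside ∷ S)  (inside ∷ T)  U             ≢ = refl
  coef-degree (inside ∷ S)  (outside ∷ T) (inside ∷ U)  ≢ = coef-degree S T U (≢ ∘′ ≡.cong suc)
  coef-degree (inside ∷ S)  (outside ∷ T) (outside ∷ U) ≢ = refl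
  coef-degree (outside ∷ S) (inside ∷ T)  (inside ∷ U)  ≢ =
    trans (*-congˡ (coef-degree S T U λ eq → ≢ (≡.trans (≡.cong suc eq) (≡.sym (+-suc ∣ S ∣ ∣ T ∣))))) (zeroʳ _)
  coef-degree (outside ∷ S) (inside ∷ T)  (outside ∷ U) ≢ = refl
  coef-degree (outside ∷ S) (outside ∷ T) (outside ∷ U) ≢ = coef-degree S T U ≢
  coef-degree (outside ∷ S) (outside ∷ T) (inside ∷ U)  ≢ = refl

  Homog-* : ∀ {n j k} {x y : Λ n} → Homog j x → Homog k y → Homog (j +ℕ k) (x *Λ y)
  Homog-* {n} {j} {k} {x} {y} hx hy U ≢j+k = sumL-0 (allSubsets n) λ S → sumL-0 (allSubsets n) λ T → term S T
    where
    term : ∀ S T → x S * y T * coef S T U ≈ 0#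
    term S T with ∣ S ∣ ≟ℕ j | ∣ T ∣ ≟ℕ k
    ... | no ≢j       | _          = trans (*-congʳ (trans (*-congʳ (hx S ≢j)) (zeroˡ _))) (zeroˡ _)
    ... | yes _       | no ≢k      = trans (*-congʳ (trans (*-congˡ (hy T ≢k)) (zeroʳ _))) (zeroˡ _)
    ... | yes ≡.refl  | yes ≡.refl = trans (*-congˡ (coef-degree S T U ≢j+k)) (zeroʳ _)

  Homog-free₀ : ∀ {n k} {x : Λ (suc n)} → Homog k x → Homog k (free₀ x)
  Homog-free₀ hx U = hx (outside ∷ U)

  Homog-div₀ : ∀ {n k} {x : Λ (suc n)} → Homog (suc k) x → Homog k (div₀ x)
  Homog-div₀ hx U ≢k = hx (inside ∷ U) (≢k ∘′ suc-injective)

  Homog-0⇒div₀≋0 : ∀ {n} {x : Λ (suc n)} → Homog 0 x → div₀ x ≋ 0Λ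
  Homog-0⇒div₀≋0 hx U = hx (inside ∷ U) λ ()

  Homog-0⇒scalar : ∀ {n} {x : Λ n} → Homog 0 x → x ≋ x ⊥ ·Λ 1Λ
  Homog-0⇒scalar {zero}  hx [] = sym (*-identityʳ _)
  Homog-0⇒scalar {suc n} hx =
    ≋-by-parts (Homog-0⇒scalar (Homog-free₀ hx)) λ U → trans (Homog-0⇒div₀≋0 hx U) (sym (zeroʳ _))

  gradeInv-Homog : ∀ {n k} {x : Λ n} → Homog k x → gradeInv x ≋ signPow k ·Λ x
  gradeInv-Homog {k = k} {x} hx U with ∣ U ∣ ≟ℕ k
  ... | yes ≡.refl = refl
  ... | no ≢k      = trans (*-congˡ (hx U ≢k)) (trans (zeroʳ _) (sym (trans (*-congˡ (hx U ≢k)) (zeroʳ _))))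

  module _ {n : ℕ} where

    scalar-*Λ : ∀ (a : R) (y : Λ n) → (a ·Λ 1Λ) *Λ y ≋ a ·Λ y
    scalar-*Λ a y = ≋-trans (·Λ-*Λˡ a 1Λ y) λ U → *-congˡ (*Λ-identityˡ y U)

    *Λ-scalar : ∀ (a : R) (y : Λ n) → y *Λ (a ·Λ 1Λ) ≋ a ·Λ y
    *Λ-scalar a y = ≋-trans (·Λ-*Λʳ a y 1Λ) λ U → *-congˡ (*Λ-identityʳ y U)

  div₀-*Λ-degree1 : ∀ {n} {x y : Λ (suc n)} → Homog 1 x → Homog 1 y →
                    div₀ (x *Λ y) ≋ (div₀ x ⊥ ·Λ free₀ y) − (div₀ y ⊥ ·Λ free₀ x)
  div₀-*Λ-degree1 {x = x} {y} hx hy = begin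
    div₀ (x *Λ y)
      ≈⟨ div₀-*Λ x y ⟩
    (div₀ x *Λ free₀ y) +Λ (gradeInv (free₀ x) *Λ div₀ y)
      ≈⟨ +Λ-cong (*Λ-cong (Homog-0⇒scalar (Homog-div₀ hx)) ≋-refl)
                 (*Λ-cong (≋-trans (gradeInv-Homog (Homog-free₀ hx)) sign) (Homog-0⇒scalar (Homog-div₀ hy))) ⟩
    ((div₀ x ⊥ ·Λ 1Λ) *Λ free₀ y) +Λ ((-Λ free₀ x) *Λ (div₀ y ⊥ ·Λ 1Λ))
      ≈⟨ +Λ-cong (scalar-*Λ _ _) (≋-trans (-Λ-*Λˡ _ _) (-Λ-cong (*Λ-scalar _ _))) ⟩
    (div₀ x ⊥ ·Λ free₀ y) − (div₀ y ⊥ ·Λ free₀ x) ∎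
    where
    open ≋-Reasoning
    sign : signPow 1 ·Λ free₀ x ≋ -Λ free₀ x
    sign U = trans (sym (-‿distribˡ-* _ _)) (-‿cong (*-identityˡ _))

  *Λ-anticomm : ∀ {n} {x y : Λ n} → Homog 1 x → Homog 1 y → x *Λ y ≋ -Λ (y *Λ x)
  *Λ-anticomm {zero} {x} {y} hx hy [] = trans (*Λ-[] x y) (trans (*-congʳ (hx [] λ ())) (trans (zeroˡ _)
    (sym (trans (-‿cong (trans (*Λ-[] y x) (trans (*-congʳ (hy [] λ ())) (zeroˡ _)))) -0#≈0#))))
  *Λ-anticomm {suc n} {x} {y} hx hy = ≋-by-parts
    (≋-trans (free₀-*Λ x y) (≋-trans (*Λ-anticomm (Homog-free₀ hx) (Homog-free₀ hy)) (-Λ-cong (≋-sym (free₀-*Λ y x)))))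
    (≋-trans (div₀-*Λ-degree1 hx hy) (≋-trans (≋-sym (ΛR.⁻¹-anti-homo‿- _ _)) (-Λ-cong (≋-sym (div₀-*Λ-degree1 hy hx)))))

  *Λ-square : ∀ {n} {x : Λ n} → Homog 1 x → x *Λ x ≋ 0Λ
  *Λ-square {zero}  {x} hx [] = trans (*Λ-[] x x) (trans (*-congʳ (hx [] λ ())) (zeroˡ _))
  *Λ-square {suc n} {x} hx = ≋-by-parts
    (≋-trans (free₀-*Λ x x) (*Λ-square (Homog-free₀ hx)))
    (λ U → trans (div₀-*Λ-degree1 hx hx U) (-‿inverseʳ _))

  e : ∀ {n} → Fin n → Λ n
  e i = δ ⁅ i ⁆

  e-Homog : ∀ {n} (i : Fin n) → Homog 1 (e i)
  e-Homog zero    (inside ∷ U)  ≢1 = Homog-1 U (≢1 ∘′ ≡.cong suc)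
  e-Homog zero    (outside ∷ U) ≢1 = refl
  e-Homog (suc i) (inside ∷ U)  ≢1 = refl
  e-Homog (suc i) (outside ∷ U) ≢1 = e-Homog i U ≢1

  shift : ∀ {n} → Λ n → Λ (suc n)
  shift x (outside ∷ U) = x U
  shift x (inside ∷ U)  = 0#

  module _ {n : ℕ} where

    shift-cong : ∀ {x y : Λ n} → x ≋ y → shift x ≋ shift y
    shift-cong p = ≋-by-parts p λ U → refl

    shift-+Λ : ∀ (x y : Λ n) → shift (x +Λ y) ≋ shift x +Λ shift y
    shift-+Λ x y = ≋-by-parts ≋-refl λ U → sym (+-identityʳ 0#)

    shift-0 : shift (0Λ {n}) ≋ 0Λ
    shift-0 = ≋-by-parts ≋-refl λ U → refl

    shift-*Λ : ∀ (x y : Λ n) → shift (x *Λ y) ≋ shift x *Λ shift y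
    shift-*Λ x y = ≋-by-parts (≋-sym (free₀-*Λ (shift x) (shift y))) (≋-sym (begin
      div₀ (shift x *Λ shift y)                                                        ≈⟨ div₀-*Λ _ _ ⟩
      (div₀ (shift x) *Λ free₀ (shift y)) +Λ (gradeInv (free₀ (shift x)) *Λ div₀ (shift y)) ≈⟨ +Λ-cong (*Λ-zeroˡ _) (*Λ-zeroʳ _) ⟩
      0Λ +Λ 0Λ                                                                         ≈⟨ +Λ-identityˡ _ ⟩
      0Λ                                                                               ∎))
      where open ≋-Reasoning

    shift-Homog : ∀ {k} {x : Λ n} → Homog k x → Homog k (shift x)
    shift-Homog hx (outside ∷ U) = hx U
    shift-Homog hx (inside ∷ U)  = λ _ → refl

    e-suc : ∀ (i : Fin n) → e (suc i) ≋ shift (e i)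
    e-suc i = ≋-by-parts ≋-refl λ U → refl

  decompose₀ : ∀ {n} (x : Λ (suc n)) → x ≋ shift (free₀ x) +Λ (e zero *Λ shift (div₀ x))
  decompose₀ x = ≋-by-parts (≋-sym free-part) (≋-sym div-part)
    where
    open ≋-Reasoning
    free-part : free₀ (shift (free₀ x) +Λ (e zero *Λ shift (div₀ x))) ≋ free₀ x
    free-part = begin
      free₀ x +Λ free₀ (e zero *Λ shift (div₀ x)) ≈⟨ +Λ-cong ≋-refl (free₀-*Λ (e zero) _) ⟩
      free₀ x +Λ (0Λ *Λ div₀ x)                   ≈⟨ +Λ-cong ≋-refl (*Λ-zeroˡ _) ⟩
      free₀ x +Λ 0Λ                               ≈⟨ +Λ-identityʳ _ ⟩
      free₀ x                                     ∎
    div-part : div₀ (shift (free₀ x) +Λ (e zero *Λ shift (div₀ x))) ≋ div₀ x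
    div-part = begin
      0Λ +Λ div₀ (e zero *Λ shift (div₀ x))          ≈⟨ +Λ-identityˡ _ ⟩
      div₀ (e zero *Λ shift (div₀ x))                ≈⟨ div₀-*Λ (e zero) _ ⟩
      (1Λ *Λ div₀ x) +Λ (gradeInv 0Λ *Λ 0Λ)          ≈⟨ +Λ-cong (*Λ-identityˡ _) (*Λ-zeroʳ _) ⟩
      div₀ x +Λ 0Λ                                   ≈⟨ +Λ-identityʳ _ ⟩
      div₀ x                                         ∎

  shiftBy : ∀ a {n} → Λ n → Λ (a +ℕ n)
  shiftBy zero    x = x
  shiftBy (suc a) x = shift (shiftBy a x)

  module _ {n : ℕ} where

    shiftBy-cong : ∀ a {x y : Λ n} → x ≋ y → shiftBy a x ≋ shiftBy a y
    shiftBy-cong zero    p = p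
    shiftBy-cong (suc a) p = shift-cong (shiftBy-cong a p)

    shiftBy-+Λ : ∀ a (x y : Λ n) → shiftBy a (x +Λ y) ≋ shiftBy a x +Λ shiftBy a y
    shiftBy-+Λ zero    x y = ≋-refl
    shiftBy-+Λ (suc a) x y = ≋-trans (shift-cong (shiftBy-+Λ a x y)) (shift-+Λ _ _)

    shiftBy-0 : ∀ a → shiftBy a (0Λ {n}) ≋ 0Λ
    shiftBy-0 zero    = ≋-refl
    shiftBy-0 (suc a) = ≋-trans (shift-cong (shiftBy-0 a)) shift-0

    shiftBy-*Λ : ∀ a (x y : Λ n) → shiftBy a (x *Λ y) ≋ shiftBy a x *Λ shiftBy a y
    shiftBy-*Λ zero    x y = ≋-refl
    shiftBy-*Λ (suc a) x y = ≋-trans (shift-cong (shiftBy-*Λ a x y)) (shift-*Λ _ _)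

    shiftBy-Homog : ∀ a {k} {x : Λ n} → Homog k x → Homog k (shiftBy a x)
    shiftBy-Homog zero    hx = hx
    shiftBy-Homog (suc a) hx = shift-Homog (shiftBy-Homog a hx)

    e-↑ʳ : ∀ a (i : Fin n) → e (a ↑ʳ i) ≋ shiftBy a (e i)
    e-↑ʳ zero    i = ≋-refl
    e-↑ʳ (suc a) i = ≋-trans (e-suc (a ↑ʳ i)) (shift-cong (e-↑ʳ a i))

module AbelianGroupIdentities {a ℓ} (G : AbelianGroup a ℓ) where

  import Algebra.Properties.AbelianGroup as AbelianGroupProperties
  import Relation.Binary.Reasoning.Setoid as SetoidReasoning
  open AbelianGroup G
  open AbelianGroupProperties G
  open SetoidReasoning setoid

  infixl 6 _−_
  _−_ : Carrier → Carrier → Carrier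
  x − y = x ∙ y ⁻¹

  −-cancelʳ : ∀ x y t → (x ∙ t) − (y ∙ t) ≈ x − y
  −-cancelʳ x y t = begin
    (x ∙ t) ∙ (y ∙ t) ⁻¹      ≈⟨ ∙-congˡ (⁻¹-∙-comm y t) ⟨
    (x ∙ t) ∙ (y ⁻¹ ∙ t ⁻¹)   ≈⟨ ∙-congˡ (comm (y ⁻¹) (t ⁻¹)) ⟩
    (x ∙ t) ∙ (t ⁻¹ ∙ y ⁻¹)   ≈⟨ assoc x t _ ⟩
    x ∙ (t ∙ (t ⁻¹ ∙ y ⁻¹))   ≈⟨ ∙-congˡ (assoc t (t ⁻¹) (y ⁻¹)) ⟨
    x ∙ ((t ∙ t ⁻¹) ∙ y ⁻¹)   ≈⟨ ∙-congˡ (∙-congʳ (inverseʳ t)) ⟩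
    x ∙ (ε ∙ y ⁻¹)            ≈⟨ ∙-congˡ (identityˡ (y ⁻¹)) ⟩
    x ∙ y ⁻¹                  ∎

  −-telescope : ∀ x y z → (x − y) ∙ (y − z) ≈ x − z
  −-telescope x y z = begin
    (x ∙ y ⁻¹) ∙ (y ∙ z ⁻¹)   ≈⟨ assoc x (y ⁻¹) _ ⟩
    x ∙ (y ⁻¹ ∙ (y ∙ z ⁻¹))   ≈⟨ ∙-congˡ (assoc (y ⁻¹) y (z ⁻¹)) ⟨
    x ∙ ((y ⁻¹ ∙ y) ∙ z ⁻¹)   ≈⟨ ∙-congˡ (∙-congʳ (inverseˡ y)) ⟩
    x ∙ (ε ∙ z ⁻¹)            ≈⟨ ∙-congˡ (identityˡ (z ⁻¹)) ⟩
    x ∙ z ⁻¹                  ∎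

  ∙−-cancel : ∀ x y z → (x ∙ (y − z)) ∙ (z − y) ≈ x
  ∙−-cancel x y z = begin
    (x ∙ (y − z)) ∙ (z − y)   ≈⟨ assoc x _ _ ⟩
    x ∙ ((y − z) ∙ (z − y))   ≈⟨ ∙-congˡ (−-telescope y z y) ⟩
    x ∙ (y ∙ y ⁻¹)            ≈⟨ ∙-congˡ (inverseʳ y) ⟩
    x ∙ ε                     ≈⟨ identityʳ x ⟩
    x                         ∎

  ∙−-identity : ∀ x y → x ∙ (y − x) ≈ y
  ∙−-identity x y = begin
    x ∙ (y ∙ x ⁻¹)   ≈⟨ ∙-congˡ (comm y (x ⁻¹)) ⟩
    x ∙ (x ⁻¹ ∙ y)   ≈⟨ assoc x (x ⁻¹) y ⟨
    (x ∙ x ⁻¹) ∙ y   ≈⟨ ∙-congʳ (inverseʳ x) ⟩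
    ε ∙ y            ≈⟨ identityˡ y ⟩
    y                ∎

  −-regroup : ∀ w x y z → w − (x ∙ (y − z)) ≈ (w − y) ∙ (z − x)
  −-regroup w x y z = begin
    w ∙ (x ∙ (y ∙ z ⁻¹)) ⁻¹         ≈⟨ ∙-congˡ (⁻¹-∙-comm x _) ⟨
    w ∙ (x ⁻¹ ∙ (y ∙ z ⁻¹) ⁻¹)      ≈⟨ ∙-congˡ (∙-congˡ (⁻¹-anti-homo‿- y z)) ⟩
    w ∙ (x ⁻¹ ∙ (z ∙ y ⁻¹))         ≈⟨ ∙-congˡ (comm (x ⁻¹) _) ⟩
    w ∙ ((z ∙ y ⁻¹) ∙ x ⁻¹)         ≈⟨ ∙-congˡ (∙-congʳ (comm z (y ⁻¹))) ⟩
    w ∙ ((y ⁻¹ ∙ z) ∙ x ⁻¹)         ≈⟨ ∙-congˡ (assoc (y ⁻¹) z (x ⁻¹)) ⟩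
    w ∙ (y ⁻¹ ∙ (z ∙ x ⁻¹))         ≈⟨ assoc w (y ⁻¹) _ ⟨
    (w ∙ y ⁻¹) ∙ (z ∙ x ⁻¹)         ∎

  −-−-assoc : ∀ x y z → x − (y − z) ≈ (x ∙ z) − y
  −-−-assoc x y z = begin
    x ∙ (y ∙ z ⁻¹) ⁻¹   ≈⟨ ∙-congˡ (⁻¹-anti-homo‿- y z) ⟩
    x ∙ (z ∙ y ⁻¹)      ≈⟨ assoc x z (y ⁻¹) ⟨
    (x ∙ z) ∙ y ⁻¹      ∎

  −∙-comm : ∀ x y z → (x − y) ∙ z ≈ (z ∙ x) − y
  −∙-comm x y z = begin
    (x ∙ y ⁻¹) ∙ z      ≈⟨ comm _ z ⟩
    z ∙ (x ∙ y ⁻¹)      ≈⟨ assoc z x (y ⁻¹) ⟨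
    (z ∙ x) ∙ y ⁻¹      ∎

  −⁻¹ : ∀ x y → x − y ⁻¹ ≈ x ∙ y
  −⁻¹ x y = ∙-congˡ (⁻¹-involutive y)

module Substitution {c ℓ} (K : CommutativeRing c ℓ) where

  import Algebra.Properties.CommutativeSemigroup as CommutativeSemigroupProperties
  open import Data.Fin using (Fin; zero; suc; _↑ʳ_)
  open import Data.Fin.Subset using (Subset; inside; outside; _∈_; ⊥)
  open import Data.List using (List; []; _∷_; _++_; map)
  import Data.List.Properties as List
  open import Data.List.Relation.Unary.All using (All; []; _∷_)
  import Data.List.Relation.Unary.All.Properties as All
  open import Data.Nat using (ℕ; zero; suc) renaming (_+_ to _+ℕ_)
  open import Data.Product using (_×_; _,_; proj₁; proj₂)
  open import Data.Vec using ([]; _∷_; here; there) renaming (_++_ to _++ᵛ_)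
  open import Function using (_∘_)
  import Relation.Binary.PropositionalEquality as ≡

  open CommutativeRing K renaming (Carrier to R) hiding (zero)
  open ExteriorAlgebra K
  open import Algebra.Properties.Ring ring using (-1*x≈-x)
  module Λ-identities {n : ℕ} = AbelianGroupIdentities (ΛR.+-abelianGroup {n})

  private
    interchange : ∀ {N} (w x y z : Λ N) → (w +Λ x) +Λ (y +Λ z) ≋ (w +Λ y) +Λ (x +Λ z)
    interchange = CommutativeSemigroupProperties.interchange ΛR.+-commutativeSemigroup

  -- eval v substitutes v i for the generator eᵢ.
  eval : ∀ {k N} → (Fin k → Λ N) → Λ k → Λ N
  eval {zero}  v x = x [] ·Λ 1Λ
  eval {suc k} v x = eval (v ∘ suc) (free₀ x) +Λ (v zero *Λ eval (v ∘ suc) (div₀ x))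

  module _ {N : ℕ} where
    open ≋-Reasoning

    eval-cong : ∀ {k} (v : Fin k → Λ N) {x y : Λ k} → x ≋ y → eval v x ≋ eval v y
    eval-cong {zero}  v x≋y U = *-congʳ (x≋y [])
    eval-cong {suc k} v x≋y =
      +Λ-cong (eval-cong (v ∘ suc) (x≋y ∘ (outside ∷_))) (*Λ-cong ≋-refl (eval-cong (v ∘ suc) (x≋y ∘ (inside ∷_))))

    eval-congᵛ : ∀ {k} {v w : Fin k → Λ N} → (∀ i → v i ≋ w i) → (x : Λ k) → eval v x ≋ eval w x
    eval-congᵛ {zero}  v≋w x = ≋-refl
    eval-congᵛ {suc k} v≋w x =
      +Λ-cong (eval-congᵛ (v≋w ∘ suc) _) (*Λ-cong (v≋w zero) (eval-congᵛ (v≋w ∘ suc) _))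

    eval-0 : ∀ {k} (v : Fin k → Λ N) → eval v 0Λ ≋ 0Λ
    eval-0 {zero}  v U = zeroˡ _
    eval-0 {suc k} v = begin
      eval (v ∘ suc) 0Λ +Λ (v zero *Λ eval (v ∘ suc) 0Λ) ≈⟨ +Λ-cong (eval-0 (v ∘ suc)) (*Λ-cong ≋-refl (eval-0 (v ∘ suc))) ⟩
      0Λ +Λ (v zero *Λ 0Λ)                                ≈⟨ +Λ-identityˡ _ ⟩
      v zero *Λ 0Λ                                        ≈⟨ *Λ-zeroʳ _ ⟩
      0Λ                                                  ∎

    eval-1 : ∀ {k} (v : Fin k → Λ N) → eval v 1Λ ≋ 1Λ
    eval-1 {zero}  v U = *-identityˡ _
    eval-1 {suc k} v = begin
      eval (v ∘ suc) 1Λ +Λ (v zero *Λ eval (v ∘ suc) 0Λ) ≈⟨ +Λ-cong (eval-1 (v ∘ suc)) (*Λ-cong ≋-refl (eval-0 (v ∘ suc))) ⟩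
      1Λ +Λ (v zero *Λ 0Λ)                                ≈⟨ +Λ-cong ≋-refl (*Λ-zeroʳ _) ⟩
      1Λ +Λ 0Λ                                            ≈⟨ +Λ-identityʳ _ ⟩
      1Λ                                                  ∎

    eval-+Λ : ∀ {k} (v : Fin k → Λ N) (x y : Λ k) → eval v (x +Λ y) ≋ eval v x +Λ eval v y
    eval-+Λ {zero}  v x y U = distribʳ _ _ _
    eval-+Λ {suc k} v x y = begin
      eval v′ (free₀ (x +Λ y)) +Λ (v zero *Λ eval v′ (div₀ (x +Λ y)))
        ≈⟨ +Λ-cong (eval-+Λ v′ _ _) (≋-trans (*Λ-cong ≋-refl (eval-+Λ v′ _ _)) (*Λ-distribˡ _ _ _)) ⟩
      (eval v′ (free₀ x) +Λ eval v′ (free₀ y)) +Λ ((v zero *Λ eval v′ (div₀ x)) +Λ (v zero *Λ eval v′ (div₀ y)))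
        ≈⟨ interchange _ _ _ _ ⟩
      eval v x +Λ eval v y ∎
      where v′ = v ∘ suc

    eval-·Λ : ∀ {k} (v : Fin k → Λ N) (a : R) (x : Λ k) → eval v (a ·Λ x) ≋ a ·Λ eval v x
    eval-·Λ {zero}  v a x U = *-assoc _ _ _
    eval-·Λ {suc k} v a x = begin
      eval v′ (free₀ (a ·Λ x)) +Λ (v zero *Λ eval v′ (div₀ (a ·Λ x)))
        ≈⟨ +Λ-cong (eval-·Λ v′ a _) (≋-trans (*Λ-cong ≋-refl (eval-·Λ v′ a _)) (·Λ-*Λʳ _ _ _)) ⟩
      (a ·Λ eval v′ (free₀ x)) +Λ (a ·Λ (v zero *Λ eval v′ (div₀ x)))
        ≈⟨ (λ U → sym (distribˡ a _ _)) ⟩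
      a ·Λ eval v x ∎
      where v′ = v ∘ suc

    eval-neg : ∀ {k} (v : Fin k → Λ N) (x : Λ k) → eval v (-Λ x) ≋ -Λ eval v x
    eval-neg v x = begin
      eval v (-Λ x)           ≈⟨ eval-cong v (λ U → sym (-1*x≈-x (x U))) ⟩
      eval v ((- 1#) ·Λ x)    ≈⟨ eval-·Λ v (- 1#) x ⟩
      (- 1#) ·Λ eval v x      ≈⟨ (λ U → -1*x≈-x _) ⟩
      -Λ eval v x             ∎

    eval-e : ∀ {k} (v : Fin k → Λ N) (i : Fin k) → eval v (e i) ≋ v i
    eval-e {suc k} v zero = begin
      eval (v ∘ suc) 0Λ +Λ (v zero *Λ eval (v ∘ suc) 1Λ) ≈⟨ +Λ-cong (eval-0 (v ∘ suc)) (*Λ-cong ≋-refl (eval-1 (v ∘ suc))) ⟩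
      0Λ +Λ (v zero *Λ 1Λ)                                ≈⟨ +Λ-identityˡ _ ⟩
      v zero *Λ 1Λ                                        ≈⟨ *Λ-identityʳ _ ⟩
      v zero                                              ∎
    eval-e {suc k} v (suc i) = begin
      eval (v ∘ suc) (e i) +Λ (v zero *Λ eval (v ∘ suc) 0Λ) ≈⟨ +Λ-cong (eval-e (v ∘ suc) i) (*Λ-cong ≋-refl (eval-0 (v ∘ suc))) ⟩
      v (suc i) +Λ (v zero *Λ 0Λ)                           ≈⟨ +Λ-cong ≋-refl (*Λ-zeroʳ _) ⟩
      v (suc i) +Λ 0Λ                                       ≈⟨ +Λ-identityʳ _ ⟩
      v (suc i)                                             ∎

    eval-shift : ∀ {k} (v : Fin (suc k) → Λ N) (x : Λ k) → eval v (shift x) ≋ eval (v ∘ suc) x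
    eval-shift v x = begin
      eval (v ∘ suc) x +Λ (v zero *Λ eval (v ∘ suc) 0Λ) ≈⟨ +Λ-cong ≋-refl (*Λ-cong ≋-refl (eval-0 (v ∘ suc))) ⟩
      eval (v ∘ suc) x +Λ (v zero *Λ 0Λ)                ≈⟨ +Λ-cong ≋-refl (*Λ-zeroʳ _) ⟩
      eval (v ∘ suc) x +Λ 0Λ                            ≈⟨ +Λ-identityʳ _ ⟩
      eval (v ∘ suc) x                                  ∎

    eval-shiftBy : ∀ a {k} (v : Fin (a +ℕ k) → Λ N) (x : Λ k) → eval v (shiftBy a x) ≋ eval (v ∘ (a ↑ʳ_)) x
    eval-shiftBy zero    v x = ≋-refl
    eval-shiftBy (suc a) v x = ≋-trans (eval-shift v (shiftBy a x)) (eval-shiftBy a (v ∘ suc) x)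

    eval-*Λ-comm : ∀ {k} (v : Fin k → Λ N) (u : Λ N) → (∀ i → v i *Λ u ≋ -Λ (u *Λ v i)) →
                   (z : Λ k) → eval v z *Λ u ≋ u *Λ eval v (gradeInv z)
    eval-*Λ-comm {zero} v u anticomm z = begin
      (z [] ·Λ 1Λ) *Λ u                ≈⟨ scalar-*Λ _ _ ⟩
      z [] ·Λ u                        ≈⟨ (λ U → *-congʳ (sym (gradeInv-[] z []))) ⟩
      gradeInv z [] ·Λ u               ≈⟨ *Λ-scalar _ _ ⟨
      u *Λ (gradeInv z [] ·Λ 1Λ)       ∎
    eval-*Λ-comm {suc k} v u anticomm z = begin
      (eval v′ (free₀ z) +Λ (v zero *Λ eval v′ (div₀ z))) *Λ u
        ≈⟨ *Λ-distribʳ _ _ _ ⟩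
      (eval v′ (free₀ z) *Λ u) +Λ ((v zero *Λ eval v′ (div₀ z)) *Λ u)
        ≈⟨ +Λ-cong (eval-*Λ-comm v′ u (anticomm ∘ suc) _) (*Λ-assoc _ _ _) ⟩
      (u *Λ eval v′ (gradeInv (free₀ z))) +Λ (v zero *Λ (eval v′ (div₀ z) *Λ u))
        ≈⟨ +Λ-cong ≋-refl (*Λ-cong ≋-refl (eval-*Λ-comm v′ u (anticomm ∘ suc) _)) ⟩
      (u *Λ eval v′ (gradeInv (free₀ z))) +Λ (v zero *Λ (u *Λ eval v′ (gradeInv (div₀ z))))
        ≈⟨ +Λ-cong ≋-refl (*Λ-assoc _ _ _) ⟨
      (u *Λ eval v′ (gradeInv (free₀ z))) +Λ ((v zero *Λ u) *Λ eval v′ (gradeInv (div₀ z)))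
        ≈⟨ +Λ-cong ≋-refl (≋-trans (*Λ-cong (anticomm zero) ≋-refl) (≋-trans (-Λ-*Λˡ _ _) (-Λ-cong (*Λ-assoc _ _ _)))) ⟩
      (u *Λ eval v′ (gradeInv (free₀ z))) +Λ (-Λ (u *Λ (v zero *Λ eval v′ (gradeInv (div₀ z)))))
        ≈⟨ +Λ-cong ≋-refl (≋-trans (*Λ-cong ≋-refl (*Λ-cong ≋-refl (≋-trans (eval-cong v′ (div₀-gradeInv z)) (eval-neg v′ _))))
             (≋-trans (*Λ-cong ≋-refl (-Λ-*Λʳ _ _)) (-Λ-*Λʳ _ _))) ⟨
      (u *Λ eval v′ (free₀ (gradeInv z))) +Λ (u *Λ (v zero *Λ eval v′ (div₀ (gradeInv z))))
        ≈⟨ *Λ-distribˡ _ _ _ ⟨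
      u *Λ eval v (gradeInv z) ∎
      where v′ = v ∘ suc

    module _ {k} (v : Fin k → Λ N) {u : Λ N} (anticomm : ∀ i → v i *Λ u ≋ -Λ (u *Λ v i)) where

      eval-*Λ-comm-assoc : ∀ z w → u *Λ (eval v (gradeInv z) *Λ w) ≋ eval v z *Λ (u *Λ w)
      eval-*Λ-comm-assoc z w = begin
        u *Λ (eval v (gradeInv z) *Λ w)   ≈⟨ *Λ-assoc _ _ _ ⟨
        (u *Λ eval v (gradeInv z)) *Λ w   ≈⟨ *Λ-cong (eval-*Λ-comm v u anticomm z) ≋-refl ⟨
        (eval v z *Λ u) *Λ w              ≈⟨ *Λ-assoc _ _ _ ⟩
        eval v z *Λ (u *Λ w)              ∎

      *Λ-eval-*Λ-square : Homog 1 u → ∀ z w → (u *Λ eval v z) *Λ (u *Λ w) ≋ 0Λ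
      *Λ-eval-*Λ-square hu z w = begin
        (u *Λ eval v z) *Λ (u *Λ w)                ≈⟨ *Λ-assoc _ _ _ ⟩
        u *Λ (eval v z *Λ (u *Λ w))                ≈⟨ *Λ-cong ≋-refl (eval-*Λ-comm-assoc z w) ⟨
        u *Λ (u *Λ (eval v (gradeInv z) *Λ w))     ≈⟨ *Λ-assoc _ _ _ ⟨
        (u *Λ u) *Λ (eval v (gradeInv z) *Λ w)     ≈⟨ *Λ-cong (*Λ-square hu) ≋-refl ⟩
        0Λ *Λ (eval v (gradeInv z) *Λ w)           ≈⟨ *Λ-zeroˡ _ ⟩
        0Λ                                         ∎

    -- With x = x₀ + e₀x₁, y = y₀ + e₀y₁, u = v zero and Φ = eval (v ∘ suc): Φx₀ · u = u · Φ(gradeInv x₀)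
    -- matches the sign in div₀-*Λ, and the extra term u Φx₁ u Φy₁ of Φx · Φy vanishes since u u = 0.
    eval-*Λ : ∀ {k} (v : Fin k → Λ N) → (∀ i → Homog 1 (v i)) → (x y : Λ k) → eval v (x *Λ y) ≋ eval v x *Λ eval v y
    eval-*Λ {zero} v hv x y = begin
      (x *Λ y) [] ·Λ 1Λ             ≈⟨ (λ U → *-congʳ (*Λ-[] x y)) ⟩
      (x [] * y []) ·Λ 1Λ           ≈⟨ (λ U → *-assoc _ _ _) ⟩
      x [] ·Λ (y [] ·Λ 1Λ)          ≈⟨ scalar-*Λ _ _ ⟨
      (x [] ·Λ 1Λ) *Λ (y [] ·Λ 1Λ)  ∎
    eval-*Λ {suc k} v hv x y = begin
      eval v′ (free₀ (x *Λ y)) +Λ (u *Λ eval v′ (div₀ (x *Λ y)))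
        ≈⟨ +Λ-cong (eval-cong v′ (free₀-*Λ x y)) (*Λ-cong ≋-refl (eval-cong v′ (div₀-*Λ x y))) ⟩
      eval v′ (free₀ x *Λ free₀ y) +Λ (u *Λ eval v′ ((div₀ x *Λ free₀ y) +Λ (gradeInv (free₀ x) *Λ div₀ y)))
        ≈⟨ +Λ-cong (eval-*Λ v′ hv′ _ _) (*Λ-cong ≋-refl (≋-trans (eval-+Λ v′ _ _) (+Λ-cong (eval-*Λ v′ hv′ _ _) (eval-*Λ v′ hv′ _ _)))) ⟩
      (A *Λ C) +Λ (u *Λ ((B *Λ C) +Λ (eval v′ (gradeInv (free₀ x)) *Λ D)))
        ≈⟨ +Λ-cong ≋-refl (≋-trans (*Λ-distribˡ _ _ _) (+Λ-cong (≋-sym (*Λ-assoc _ _ _)) (eval-*Λ-comm-assoc v′ anticomm (free₀ x) D))) ⟩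
      (A *Λ C) +Λ (((u *Λ B) *Λ C) +Λ (A *Λ (u *Λ D)))
        ≈⟨ ΛR.+-congˡ (ΛR.+-comm _ _) ⟩
      (A *Λ C) +Λ ((A *Λ (u *Λ D)) +Λ ((u *Λ B) *Λ C))
        ≈⟨ ΛR.+-assoc _ _ _ ⟨
      ((A *Λ C) +Λ (A *Λ (u *Λ D))) +Λ ((u *Λ B) *Λ C)
        ≈⟨ +Λ-cong ≋-refl (≋-trans (≋-sym (+Λ-identityʳ _)) (+Λ-cong ≋-refl (≋-sym (*Λ-eval-*Λ-square v′ anticomm (hv zero) (div₀ x) D)))) ⟩
      ((A *Λ C) +Λ (A *Λ (u *Λ D))) +Λ (((u *Λ B) *Λ C) +Λ ((u *Λ B) *Λ (u *Λ D)))
        ≈⟨ +Λ-cong (*Λ-distribˡ _ _ _) (*Λ-distribˡ _ _ _) ⟨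
      (A *Λ (C +Λ (u *Λ D))) +Λ ((u *Λ B) *Λ (C +Λ (u *Λ D)))
        ≈⟨ *Λ-distribʳ _ _ _ ⟨
      eval v x *Λ eval v y ∎
      where
      v′ = v ∘ suc
      hv′ = hv ∘ suc
      u = v zero
      A = eval v′ (free₀ x) ; B = eval v′ (div₀ x) ; C = eval v′ (free₀ y) ; D = eval v′ (div₀ y)
      anticomm : ∀ i → v′ i *Λ u ≋ -Λ (u *Λ v′ i)
      anticomm i = *Λ-anticomm (hv′ i) (hv zero)

    eval-Homog : ∀ {k} (v : Fin k → Λ N) → (∀ i → Homog 1 (v i)) → ∀ {d} {x : Λ k} → Homog d x → Homog d (eval v x)
    eval-Homog {zero}  v hv {zero}      hx = Homog-· _ Homog-1
    eval-Homog {zero}  v hv {suc d} {x} hx = Homog-cong (λ U → sym (trans (*-congʳ (hx [] λ ())) (zeroˡ _))) Homog-0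
    eval-Homog {suc k} v hv {zero}  {x} hx = Homog-+ (eval-Homog (v ∘ suc) (hv ∘ suc) (Homog-free₀ hx)) (Homog-cong (≋-sym e₀-part≋0) Homog-0)
      where
      e₀-part≋0 : v zero *Λ eval (v ∘ suc) (div₀ x) ≋ 0Λ
      e₀-part≋0 = ≋-trans (*Λ-cong ≋-refl (≋-trans (eval-cong (v ∘ suc) (Homog-0⇒div₀≋0 hx)) (eval-0 (v ∘ suc)))) (*Λ-zeroʳ _)
    eval-Homog {suc k} v hv {suc d} hx =
      Homog-+ (eval-Homog (v ∘ suc) (hv ∘ suc) (Homog-free₀ hx)) (Homog-* (hv zero) (eval-Homog (v ∘ suc) (hv ∘ suc) (Homog-div₀ hx)))

  eval-shiftᵛ : ∀ {k N} (v : Fin k → Λ N) (x : Λ k) → eval (shift ∘ v) x ≋ shift (eval v x)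
  eval-shiftᵛ {zero}  v x = ≋-by-parts ≋-refl λ U → zeroʳ _
  eval-shiftᵛ {suc k} v x = begin
    eval (shift ∘ v′) (free₀ x) +Λ (shift (v zero) *Λ eval (shift ∘ v′) (div₀ x))
      ≈⟨ +Λ-cong (eval-shiftᵛ v′ _) (*Λ-cong ≋-refl (eval-shiftᵛ v′ _)) ⟩
    shift (eval v′ (free₀ x)) +Λ (shift (v zero) *Λ shift (eval v′ (div₀ x)))
      ≈⟨ +Λ-cong ≋-refl (shift-*Λ _ _) ⟨
    shift (eval v′ (free₀ x)) +Λ shift (v zero *Λ eval v′ (div₀ x))
      ≈⟨ shift-+Λ _ _ ⟨
    shift (eval v x) ∎
    where
    open ≋-Reasoning
    v′ = v ∘ suc

  eval-shiftByᵛ : ∀ a {k N} (v : Fin k → Λ N) (x : Λ k) → eval (shiftBy a ∘ v) x ≋ shiftBy a (eval v x)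
  eval-shiftByᵛ zero    v x = ≋-refl
  eval-shiftByᵛ (suc a) v x = ≋-trans (eval-shiftᵛ (shiftBy a ∘ v) x) (shift-cong (eval-shiftByᵛ a v x))

  eval-∘ : ∀ {k N M} (w : Fin N → Λ M) → (∀ i → Homog 1 (w i)) → (v : Fin k → Λ N) (x : Λ k) →
           eval w (eval v x) ≋ eval (eval w ∘ v) x
  eval-∘ {zero}  w hw v x = ≋-trans (eval-·Λ w _ _) λ U → *-congˡ (eval-1 w U)
  eval-∘ {suc k} w hw v x = begin
    eval w (eval v′ (free₀ x) +Λ (v zero *Λ eval v′ (div₀ x)))
      ≈⟨ eval-+Λ w _ _ ⟩
    eval w (eval v′ (free₀ x)) +Λ eval w (v zero *Λ eval v′ (div₀ x))
      ≈⟨ +Λ-cong (eval-∘ w hw v′ _) (eval-*Λ w hw _ _) ⟩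
    eval (eval w ∘ v′) (free₀ x) +Λ (eval w (v zero) *Λ eval w (eval v′ (div₀ x)))
      ≈⟨ +Λ-cong ≋-refl (*Λ-cong ≋-refl (eval-∘ w hw v′ _)) ⟩
    eval (eval w ∘ v) x ∎
    where
    open ≋-Reasoning
    v′ = v ∘ suc

  eval-e-id : ∀ {N} (x : Λ N) → eval e x ≋ x
  eval-e-id {zero}  x [] = *-identityʳ _
  eval-e-id {suc N} x = begin
    eval (e ∘ suc) (free₀ x) +Λ (e zero *Λ eval (e ∘ suc) (div₀ x))
      ≈⟨ +Λ-cong (eval-e-suc (free₀ x)) (*Λ-cong ≋-refl (eval-e-suc (div₀ x))) ⟩
    shift (free₀ x) +Λ (e zero *Λ shift (div₀ x))
      ≈⟨ decompose₀ x ⟨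
    x ∎
    where
    open ≋-Reasoning
    eval-e-suc : ∀ y → eval (e ∘ suc) y ≋ shift y
    eval-e-suc y = ≋-trans (eval-congᵛ e-suc y) (≋-trans (eval-shiftᵛ e y) (shift-cong (eval-e-id y)))

  monomial : ∀ {k N} → (Fin k → Λ N) → Subset k → Λ N
  monomial v []            = 1Λ
  monomial v (inside ∷ S)  = v zero *Λ monomial (v ∘ suc) S
  monomial v (outside ∷ S) = monomial (v ∘ suc) S

  -- ∂ of monomial v S, expanded by the rule ∂(u · m) = m − u · ∂m.
  ∂monomial : ∀ {k N} → (Fin k → Λ N) → Subset k → Λ N
  ∂monomial v []            = 0Λ
  ∂monomial v (inside ∷ S)  = monomial (v ∘ suc) S − v zero *Λ ∂monomial (v ∘ suc) S
  ∂monomial v (outside ∷ S) = ∂monomial (v ∘ suc) S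

  module _ {N : ℕ} where

    eval-δ : ∀ {k} (v : Fin k → Λ N) (S : Subset k) → eval v (δ S) ≋ monomial v S
    eval-δ v []            U = *-identityˡ _
    eval-δ v (inside ∷ S)  = ≋-trans (+Λ-cong (eval-0 (v ∘ suc)) (*Λ-cong ≋-refl (eval-δ (v ∘ suc) S))) (+Λ-identityˡ _)
    eval-δ v (outside ∷ S) = ≋-trans (+Λ-cong (eval-δ (v ∘ suc) S) (≋-trans (*Λ-cong ≋-refl (eval-0 (v ∘ suc))) (*Λ-zeroʳ _))) (+Λ-identityʳ _)

    eval-∂e : ∀ {k} (v : Fin k → Λ N) (S : Subset k) → eval v (∂e S) ≋ ∂monomial v S
    eval-∂e v []            U = zeroˡ _
    eval-∂e v (inside ∷ S)  =
      +Λ-cong (eval-δ (v ∘ suc) S) (≋-trans (*Λ-cong ≋-refl (≋-trans (eval-neg (v ∘ suc) (∂e S)) (-Λ-cong (eval-∂e (v ∘ suc) S)))) (-Λ-*Λʳ _ _))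
    eval-∂e v (outside ∷ S) = ≋-trans (+Λ-cong (eval-∂e (v ∘ suc) S) (≋-trans (*Λ-cong ≋-refl (eval-0 (v ∘ suc))) (*Λ-zeroʳ _))) (+Λ-identityʳ _)

    monomial-cong : ∀ {k} {v w : Fin k → Λ N} (S : Subset k) → (∀ {i} → i ∈ S → v i ≋ w i) → monomial v S ≋ monomial w S
    monomial-cong []            v≋w = ≋-refl
    monomial-cong (inside ∷ S)  v≋w = *Λ-cong (v≋w here) (monomial-cong S (v≋w ∘ there))
    monomial-cong (outside ∷ S) v≋w = monomial-cong S (v≋w ∘ there)

    ∂monomial-cong : ∀ {k} {v w : Fin k → Λ N} (S : Subset k) → (∀ {i} → i ∈ S → v i ≋ w i) → ∂monomial v S ≋ ∂monomial w S
    ∂monomial-cong []            v≋w = ≋-refl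
    ∂monomial-cong (inside ∷ S)  v≋w =
      +Λ-cong (monomial-cong S (v≋w ∘ there)) (-Λ-cong (*Λ-cong (v≋w here) (∂monomial-cong S (v≋w ∘ there))))
    ∂monomial-cong (outside ∷ S) v≋w = ∂monomial-cong S (v≋w ∘ there)

    monomial-⊥ : ∀ {k} (v : Fin k → Λ N) → monomial v ⊥ ≋ 1Λ
    monomial-⊥ {zero}  v = ≋-refl
    monomial-⊥ {suc k} v = monomial-⊥ (v ∘ suc)

    ∂monomial-⊥ : ∀ {k} (v : Fin k → Λ N) → ∂monomial v ⊥ ≋ 0Λ
    ∂monomial-⊥ {zero}  v = ≋-refl
    ∂monomial-⊥ {suc k} v = ∂monomial-⊥ (v ∘ suc)

  ∂e-⊥++ : ∀ a {k} (S : Subset k) → ∂e (⊥ {a} ++ᵛ S) ≋ shiftBy a (∂e S)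
  ∂e-⊥++ zero    S = ≋-refl
  ∂e-⊥++ (suc a) S = ≋-trans (≋-by-parts ≋-refl λ U → refl) (shift-cong (∂e-⊥++ a S))

  eval-∂e-fixed : ∀ {k} {v : Fin k → Λ k} (S : Subset k) → (∀ {i} → i ∈ S → v i ≋ e i) → eval v (∂e S) ≋ ∂e S
  eval-∂e-fixed {v = v} S v≋e = begin
    eval v (∂e S)     ≈⟨ eval-∂e v S ⟩
    ∂monomial v S     ≈⟨ ∂monomial-cong S v≋e ⟩
    ∂monomial e S     ≈⟨ eval-∂e e S ⟨
    eval e (∂e S)     ≈⟨ eval-e-id (∂e S) ⟩
    ∂e S              ∎
    where open ≋-Reasoning

  module _ {N : ℕ} where
    open ≋-Reasoning
    open Λ-identities {N} using (−-telescope; −-−-assoc; −∙-comm; −⁻¹)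

    ∂₃ : Λ N → Λ N → Λ N → Λ N
    ∂₃ a b c = (a − b) *Λ (b − c)

    ∂₃-expand : ∀ {a b c : Λ N} → Homog 1 b → ∂₃ a b c ≋ ((b *Λ c) +Λ (a *Λ b)) − (a *Λ c)
    ∂₃-expand {a} {b} {c} hb = begin
      (a − b) *Λ (b − c)                             ≈⟨ ΛR.[y-z]x≈yx-zx _ a b ⟩
      (a *Λ (b − c)) − (b *Λ (b − c))                ≈⟨ −-cong (ΛR.x[y-z]≈xy-xz a b c) (ΛR.x[y-z]≈xy-xz b b c) ⟩
      ((a *Λ b) − (a *Λ c)) − ((b *Λ b) − (b *Λ c))  ≈⟨ −-cong ≋-refl (≋-trans (+Λ-cong (*Λ-square hb) ≋-refl) (+Λ-identityˡ _)) ⟩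
      ((a *Λ b) − (a *Λ c)) − (-Λ (b *Λ c))          ≈⟨ −⁻¹ _ _ ⟩
      ((a *Λ b) − (a *Λ c)) +Λ (b *Λ c)              ≈⟨ −∙-comm _ _ _ ⟩
      ((b *Λ c) +Λ (a *Λ b)) − (a *Λ c)              ∎

    ∂monomial-three : ∀ {a b c D P : Λ N} → Homog 1 b → D ≋ 1Λ → P ≋ 0Λ →
                      (b *Λ (c *Λ D)) − (a *Λ ((c *Λ D) − (b *Λ (D − (c *Λ P))))) ≋ ∂₃ a b c
    ∂monomial-three {a} {b} {c} {D} {P} hb D≋1 P≋0 = begin
      (b *Λ (c *Λ D)) − (a *Λ ((c *Λ D) − (b *Λ (D − (c *Λ P)))))
        ≈⟨ −-cong (*Λ-cong ≋-refl cD≋c) (*Λ-cong ≋-refl (−-cong cD≋c (≋-trans (*Λ-cong ≋-refl D−cP≋1) (*Λ-identityʳ b)))) ⟩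
      (b *Λ c) − (a *Λ (c − b))                ≈⟨ −-cong ≋-refl (ΛR.x[y-z]≈xy-xz a c b) ⟩
      (b *Λ c) − ((a *Λ c) − (a *Λ b))         ≈⟨ −-−-assoc _ _ _ ⟩
      ((b *Λ c) +Λ (a *Λ b)) − (a *Λ c)        ≈⟨ ∂₃-expand hb ⟨
      ∂₃ a b c                                 ∎
      where
      cD≋c : c *Λ D ≋ c
      cD≋c = ≋-trans (*Λ-cong ≋-refl D≋1) (*Λ-identityʳ c)
      D−cP≋1 : D − (c *Λ P) ≋ 1Λ
      D−cP≋1 = ≋-trans (−-cong D≋1 (≋-trans (*Λ-cong ≋-refl P≋0) (*Λ-zeroʳ c))) (≋-trans (+Λ-cong ≋-refl ΛR.-0#≈0#) (+Λ-identityʳ _))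

    ∂monomial-four : ∀ {a b c d D P : Λ N} → Homog 1 b → Homog 1 c → D ≋ 1Λ → P ≋ 0Λ →
                     (b *Λ (c *Λ (d *Λ D))) − (a *Λ ((c *Λ (d *Λ D)) − (b *Λ ((d *Λ D) − (c *Λ (D − (d *Λ P)))))))
                       ≋ -Λ ((a − b) *Λ ∂₃ b c d)
    ∂monomial-four {a} {b} {c} {d} {D} {P} hb hc D≋1 P≋0 = begin
      (b *Λ (c *Λ (d *Λ D))) − (a *Λ ((c *Λ (d *Λ D)) − (b *Λ ((d *Λ D) − (c *Λ (D − (d *Λ P)))))))
        ≈⟨ −-cong (*Λ-cong ≋-refl (*Λ-cong ≋-refl (≋-trans (*Λ-cong ≋-refl D≋1) (*Λ-identityʳ d))))
                  (*Λ-cong ≋-refl (∂monomial-three hc D≋1 P≋0)) ⟩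
      (b *Λ (c *Λ d)) − (a *Λ X)   ≈⟨ −-cong bX≋bcd ≋-refl ⟨
      (b *Λ X) − (a *Λ X)          ≈⟨ ΛR.⁻¹-anti-homo‿- _ _ ⟨
      -Λ ((a *Λ X) − (b *Λ X))     ≈⟨ -Λ-cong (ΛR.[y-z]x≈yx-zx X a b) ⟨
      -Λ ((a − b) *Λ X)            ∎
      where
      X = ∂₃ b c d
      bX≋bcd : b *Λ X ≋ b *Λ (c *Λ d)
      bX≋bcd = begin
        b *Λ ((b − c) *Λ (c − d))                  ≈⟨ *Λ-assoc _ _ _ ⟨
        (b *Λ (b − c)) *Λ (c − d)                  ≈⟨ *Λ-cong (ΛR.x[y-z]≈xy-xz b b c) ≋-refl ⟩
        ((b *Λ b) − (b *Λ c)) *Λ (c − d)           ≈⟨ *Λ-cong (≋-trans (+Λ-cong (*Λ-square hb) ≋-refl) (+Λ-identityˡ _)) ≋-refl ⟩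
        (-Λ (b *Λ c)) *Λ (c − d)                   ≈⟨ -Λ-*Λˡ _ _ ⟩
        -Λ ((b *Λ c) *Λ (c − d))                   ≈⟨ -Λ-cong (ΛR.x[y-z]≈xy-xz _ c d) ⟩
        -Λ (((b *Λ c) *Λ c) − ((b *Λ c) *Λ d))     ≈⟨ -Λ-cong (−-cong (*Λ-assoc _ _ _) (*Λ-assoc _ _ _)) ⟩
        -Λ ((b *Λ (c *Λ c)) − (b *Λ (c *Λ d)))     ≈⟨ -Λ-cong (−-cong (≋-trans (*Λ-cong ≋-refl (*Λ-square hc)) (*Λ-zeroʳ b)) ≋-refl) ⟩
        -Λ (0Λ − (b *Λ (c *Λ d)))                  ≈⟨ -Λ-cong (+Λ-identityˡ _) ⟩
        -Λ (-Λ (b *Λ (c *Λ d)))                    ≈⟨ ΛR.-‿involutive _ ⟩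
        b *Λ (c *Λ d)                              ∎

    ∂₃-rotate : ∀ {a b c : Λ N} → Homog 1 a → Homog 1 b → Homog 1 c → ∂₃ b c a ≋ ∂₃ a b c
    ∂₃-rotate {a} {b} {c} ha hb hc = begin
      B *Λ (c − a)                ≈⟨ *Λ-cong ≋-refl c−a≋-[A+B] ⟩
      B *Λ (-Λ (A +Λ B))          ≈⟨ -Λ-*Λʳ _ _ ⟩
      -Λ (B *Λ (A +Λ B))          ≈⟨ -Λ-cong (*Λ-distribˡ _ _ _) ⟩
      -Λ ((B *Λ A) +Λ (B *Λ B))   ≈⟨ -Λ-cong (+Λ-cong (*Λ-anticomm hB hA) (*Λ-square hB)) ⟩
      -Λ ((-Λ (A *Λ B)) +Λ 0Λ)    ≈⟨ -Λ-cong (+Λ-identityʳ _) ⟩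
      -Λ (-Λ (A *Λ B))            ≈⟨ ΛR.-‿involutive _ ⟩
      A *Λ B                      ∎
      where
      A = a − b
      B = b − c
      hA = Homog-− ha hb
      hB = Homog-− hb hc
      c−a≋-[A+B] : c − a ≋ -Λ (A +Λ B)
      c−a≋-[A+B] = ≋-sym (≋-trans (-Λ-cong (−-telescope a b c)) (ΛR.⁻¹-anti-homo‿- a c))

  -- The Orlik–Solomon ideal

  module _ {N : ℕ} (M : Matroid N) where

    Generator : Set c
    Generator = Λ N × Subset N × Λ N

    term : Generator → Λ N
    term (x , C , y) = x *Λ (∂e C *Λ y)

    sumTerms : List Generator → Λ N
    sumTerms gs U = sumL (map (λ g → term g U) gs)

    GeneratedByCircuits : List Generator → Set c
    GeneratedByCircuits = All (IsCircuit M ∘ proj₁ ∘ proj₂)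

    InI-cong : ∀ {z z′} → z ≋ z′ → InI M z → InI M z′
    InI-cong z≋z′ (gs , circ , z≋) = gs , circ , λ U → trans (sym (z≋z′ U)) (z≋ U)

    InI-0 : InI M 0Λ
    InI-0 = [] , [] , λ U → refl

    sumTerms-++ : ∀ gs gs′ → sumTerms (gs ++ gs′) ≋ sumTerms gs +Λ sumTerms gs′
    sumTerms-++ gs gs′ U =
      trans (reflexive (≡.cong sumL (List.map-++ (λ g → term g U) gs gs′))) (sumL-++ (map (λ g → term g U) gs) _)

    InI-+ : ∀ {z z′} → InI M z → InI M z′ → InI M (z +Λ z′)
    InI-+ (gs , circ , z≋) (gs′ , circ′ , z′≋) =
      gs ++ gs′ , All.++⁺ circ circ′ , λ U → trans (+-cong (z≋ U) (z′≋ U)) (sym (sumTerms-++ gs gs′ U))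

    InI-generator : ∀ {C} → IsCircuit M C → InI M (∂e C)
    InI-generator {C} circ = (1Λ , C , 1Λ) ∷ [] , circ ∷ [] ,
      λ U → sym (trans (+-identityʳ _) (trans (*Λ-identityˡ _ U) (*Λ-identityʳ _ U)))

    InI-*ˡ : ∀ a {z} → InI M z → InI M (a *Λ z)
    InI-*ˡ a {z} (gs , circ , z≋) = map (λ g → a *Λ proj₁ g , proj₂ g) gs , All.map⁺ circ ,
      ≋-trans (*Λ-cong ≋-refl z≋) (*Λ-sumTerms gs)
      where
      *Λ-sumTerms : ∀ gs → a *Λ sumTerms gs ≋ sumTerms (map (λ g → a *Λ proj₁ g , proj₂ g) gs)
      *Λ-sumTerms []       = *Λ-zeroʳ a
      *Λ-sumTerms (g ∷ gs) = ≋-trans (*Λ-distribˡ a (term g) (sumTerms gs)) (+Λ-cong (≋-sym (*Λ-assoc _ _ _)) (*Λ-sumTerms gs))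

    InI-*ʳ : ∀ b {z} → InI M z → InI M (z *Λ b)
    InI-*ʳ b {z} (gs , circ , z≋) = map (λ g → proj₁ g , proj₁ (proj₂ g) , proj₂ (proj₂ g) *Λ b) gs , All.map⁺ circ ,
      ≋-trans (*Λ-cong z≋ ≋-refl) (sumTerms-*Λ gs)
      where
      sumTerms-*Λ : ∀ gs → sumTerms gs *Λ b ≋ sumTerms (map (λ g → proj₁ g , proj₁ (proj₂ g) , proj₂ (proj₂ g) *Λ b) gs)
      sumTerms-*Λ []       = *Λ-zeroˡ b
      sumTerms-*Λ (g ∷ gs) = ≋-trans (*Λ-distribʳ b (term g) (sumTerms gs))
        (+Λ-cong (≋-trans (*Λ-assoc _ _ _) (*Λ-cong ≋-refl (*Λ-assoc _ _ _))) (sumTerms-*Λ gs))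

    InI-neg : ∀ {z} → InI M z → InI M (-Λ z)
    InI-neg {z} z∈I = InI-cong (≋-trans (-Λ-*Λˡ 1Λ z) (-Λ-cong (*Λ-identityˡ z))) (InI-*ˡ (-Λ 1Λ) z∈I)

    ≋⇒~ : ∀ {x y : Λ N} → x ≋ y → x ~[ M ] y
    ≋⇒~ x≋y = InI-cong (λ U → sym (trans (+-congʳ (x≋y U)) (-‿inverseʳ _))) InI-0

  module _ {N N′ : ℕ} {M : Matroid N} {M′ : Matroid N′} (f : Λ N → Λ N′)
           (f-cong : ∀ {x y} → x ≋ y → f x ≋ f y) (f-0 : f 0Λ ≋ 0Λ)
           (f-+ : ∀ x y → f (x +Λ y) ≋ f x +Λ f y) (f-* : ∀ x y → f (x *Λ y) ≋ f x *Λ f y)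
           (f-circuits : ∀ {C} → IsCircuit M C → InI M′ (f (∂e C))) where

    homomorphism-InI : ∀ {z} → InI M z → InI M′ (f z)
    homomorphism-InI (gs , circ , z≋) = InI-cong M′ (≋-sym (f-cong z≋)) (f-sumTerms gs circ)
      where
      f-sumTerms : ∀ gs → GeneratedByCircuits M gs → InI M′ (f (sumTerms M gs))
      f-sumTerms []                 []          = InI-cong M′ (≋-sym f-0) (InI-0 M′)
      f-sumTerms ((x , C , y) ∷ gs) (circ ∷ cs) =
        InI-cong M′ (≋-sym (≋-trans (f-+ _ _) (+Λ-cong (≋-trans (f-* _ _) (*Λ-cong ≋-refl (f-* _ _))) ≋-refl)))
          (InI-+ M′ (InI-*ˡ M′ (f x) (InI-*ʳ M′ (f y) (f-circuits circ))) (f-sumTerms gs cs))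

  module _ {N : ℕ} {M M′ : Matroid N} (v : Fin N → Λ N) (hv : ∀ i → Homog 1 (v i))
           (v-circuits : ∀ {C} → IsCircuit M C → InI M′ (eval v (∂e C))) where

    eval-resp : ∀ x y → x ~[ M ] y → eval v x ~[ M′ ] eval v y
    eval-resp x y x~y = InI-cong M′ (≋-trans (eval-+Λ v _ _) (+Λ-cong ≋-refl (eval-neg v y)))
      (homomorphism-InI {M = M} {M′} (eval v) (eval-cong v) (eval-0 v) (eval-+Λ v) (eval-*Λ v hv) v-circuits x~y)

  module _ {N : ℕ} {M M′ : Matroid N} (v w : Fin N → Λ N)
           (hv : ∀ i → Homog 1 (v i)) (hw : ∀ i → Homog 1 (w i))
           (w∘v≋e : ∀ i → eval w (v i) ≋ e i) (v∘w≋e : ∀ i → eval v (w i) ≋ e i)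
           (v-circuits : ∀ {C} → IsCircuit M C → InI M′ (eval v (∂e C)))
           (w-circuits : ∀ {C} → IsCircuit M′ C → InI M (eval w (∂e C))) where

    substitutionIso : OSIso M M′
    substitutionIso = record
      { φ       = eval v
      ; ψ       = eval w
      ; φ-resp  = eval-resp {M = M} {M′} v hv v-circuits
      ; ψ-resp  = eval-resp {M = M′} {M} w hw w-circuits
      ; φ-+     = λ x y → ≋⇒~ M′ (eval-+Λ v x y)
      ; φ-·     = λ a x → ≋⇒~ M′ (eval-·Λ v a x)
      ; φ-*     = λ x y → ≋⇒~ M′ (eval-*Λ v hv x y)
      ; φ-1     = ≋⇒~ M′ (eval-1 v)
      ; φ-grade = λ k x hx → eval v x , eval-Homog v hv hx , ≋⇒~ M′ ≋-refl
      ; ψφ      = λ x → ≋⇒~ M (≋-trans (eval-∘ w hw v x) (≋-trans (eval-congᵛ w∘v≋e x) (eval-e-id x)))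
      ; φψ      = λ y → ≋⇒~ M′ (≋-trans (eval-∘ v hv w y) (≋-trans (eval-congᵛ v∘w≋e y) (eval-e-id y)))
      }

module BlockSubstitution {c ℓ} (K : CommutativeRing c ℓ) where

  open import Data.Fin using (Fin; _↑ˡ_; _↑ʳ_; splitAt)
  open import Data.Fin.Patterns using (0F; 1F; 2F; 3F; 4F; 5F)
  open import Data.Fin.Properties using (splitAt-↑ˡ; splitAt-↑ʳ)
  open import Data.Fin.Subset using (_∈_; ⊥)
  open import Data.Fin.Subset.Properties using (∉⊥)
  open import Data.List.Relation.Unary.Any using (here; there)
  open import Data.List.Membership.Propositional renaming (_∈_ to _∈ᴸ_)
  open import Data.Nat using (ℕ; suc) renaming (_+_ to _+ℕ_; _*_ to _*ℕ_)
  open import Data.Product using (∃; _×_; _,_)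
  open import Data.Sum using ([_,_]′)
  open import Data.Unit using (tt)
  open import Data.Vec using (Vec; []; _∷_; _++_; here; there)
  open import Function using (_∘_)
  open import Relation.Nullary using (contradiction)
  open import Relation.Binary.PropositionalEquality using (_≡_; cong; subst) renaming (refl to ≡-refl; sym to ≡-sym; trans to ≡-trans)

  open ExteriorAlgebra K
  open Substitution K

  module _ {a n : ℕ} (L : Matroid a) (M : Matroid n) where

    InI-shiftBy : ∀ {z} → InI M z → InI (L ⊕ M) (shiftBy a z)
    InI-shiftBy = homomorphism-InI {M = M} {L ⊕ M} (shiftBy a) (shiftBy-cong a) (shiftBy-0 a) (shiftBy-+Λ a) (shiftBy-*Λ a)
      λ {C} circ → InI-cong (L ⊕ M) (∂e-⊥++ a C) (InI-generator (L ⊕ M) (circuit-⊥++ L M circ))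

    InI-++⊥ : ∀ {C} → IsCircuit L C → InI (L ⊕ M) (∂e (C ++ ⊥))
    InI-++⊥ circ = InI-generator (L ⊕ M) (circuit-++⊥ L M circ)

  E : ∀ {n} → Fin 6 → Λ (6 +ℕ n)
  E p = e (p ↑ˡ _)

  E-Homog : ∀ {n} p → Homog 1 (E {n} p)
  E-Homog p = e-Homog (p ↑ˡ _)

  module _ {n N : ℕ} (v : Fin (6 +ℕ n) → Λ N) (hv : ∀ i → Homog 1 (v i)) where
    private
      1≋ : monomial (v ∘ (6 ↑ʳ_)) ⊥ ≋ 1Λ
      1≋ = monomial-⊥ (v ∘ (6 ↑ʳ_))
      0≋ : ∂monomial (v ∘ (6 ↑ʳ_)) ⊥ ≋ 0Λ
      0≋ = ∂monomial-⊥ (v ∘ (6 ↑ʳ_))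

    eval-∂e-line₀₁₂ : eval v (∂e (line₀₁₂ ++ ⊥)) ≋ ∂₃ (v 0F) (v 1F) (v 2F)
    eval-∂e-line₀₁₂ = ≋-trans (eval-∂e v (line₀₁₂ ++ ⊥)) (∂monomial-three {a = v 0F} {v 1F} {v 2F} (hv 1F) 1≋ 0≋)

    eval-∂e-line₃₄₅ : eval v (∂e (line₃₄₅ ++ ⊥)) ≋ ∂₃ (v 3F) (v 4F) (v 5F)
    eval-∂e-line₃₄₅ = ≋-trans (eval-∂e v (line₃₄₅ ++ ⊥)) (∂monomial-three {a = v 3F} {v 4F} {v 5F} (hv 4F) 1≋ 0≋)

    eval-∂e-line₀₃₄ : eval v (∂e (line₀₃₄ ++ ⊥)) ≋ ∂₃ (v 0F) (v 3F) (v 4F)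
    eval-∂e-line₀₃₄ = ≋-trans (eval-∂e v (line₀₃₄ ++ ⊥)) (∂monomial-three {a = v 0F} {v 3F} {v 4F} (hv 3F) 1≋ 0≋)

    eval-∂e-circuit₁₂₃₄ : eval v (∂e (circuit₁₂₃₄ ++ ⊥)) ≋ -Λ ((v 1F − v 2F) *Λ ∂₃ (v 2F) (v 3F) (v 4F))
    eval-∂e-circuit₁₂₃₄ =
      ≋-trans (eval-∂e v (circuit₁₂₃₄ ++ ⊥)) (∂monomial-four {a = v 1F} {v 2F} {v 3F} {v 4F} (hv 2F) (hv 3F) 1≋ 0≋)

  module _ {n : ℕ} where

    ∂e-line₀₁₂ : ∂e (line₀₁₂ ++ ⊥ {n}) ≋ ∂₃ (E 0F) (E 1F) (E 2F)
    ∂e-line₀₁₂ = ≋-trans (≋-sym (eval-e-id _)) (eval-∂e-line₀₁₂ e e-Homog)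

    ∂e-line₃₄₅ : ∂e (line₃₄₅ ++ ⊥ {n}) ≋ ∂₃ (E 3F) (E 4F) (E 5F)
    ∂e-line₃₄₅ = ≋-trans (≋-sym (eval-e-id _)) (eval-∂e-line₃₄₅ e e-Homog)

    ∂e-line₀₃₄ : ∂e (line₀₃₄ ++ ⊥ {n}) ≋ ∂₃ (E 0F) (E 3F) (E 4F)
    ∂e-line₀₃₄ = ≋-trans (≋-sym (eval-e-id _)) (eval-∂e-line₀₃₄ e e-Homog)

  shear : ∀ {n} → Λ (6 +ℕ n) → Fin 6 → Λ (6 +ℕ n)
  shear s 3F = E 3F +Λ s
  shear s 4F = E 4F +Λ s
  shear s p  = E p

  shear-Homog : ∀ {n} {s : Λ (6 +ℕ n)} → Homog 1 s → ∀ p → Homog 1 (shear s p)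
  shear-Homog hs 3F = Homog-+ (E-Homog 3F) hs
  shear-Homog hs 4F = Homog-+ (E-Homog 4F) hs
  shear-Homog hs 0F = E-Homog 0F
  shear-Homog hs 1F = E-Homog 1F
  shear-Homog hs 2F = E-Homog 2F
  shear-Homog hs 5F = E-Homog 5F

  shear-line₀₁₂ : ∀ {n} (s : Λ (6 +ℕ n)) {q} → q ∈ line₀₁₂ → shear s q ≡ E q
  shear-line₀₁₂ s here                 = ≡-refl
  shear-line₀₁₂ s (there here)         = ≡-refl
  shear-line₀₁₂ s (there (there here)) = ≡-refl
  shear-line₀₁₂ s (there (there (there (there (there (there ()))))))

  shear-inverse : ∀ {n} (W : Fin (6 +ℕ n) → Λ (6 +ℕ n)) {y z : Fin 6} →
                  W (y ↑ˡ n) ≋ E y → W (z ↑ˡ n) ≋ E z → (∀ q → W (q ↑ˡ n) ≋ shear (E y − E z) q) →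
                  ∀ p → eval W (shear (E z − E y) p) ≋ E p
  shear-inverse {n} W {y} {z} Wy≋ Wz≋ W≋ = λ where
      3F → unshear 3F (W≋ 3F)
      4F → unshear 4F (W≋ 4F)
      0F → fixed 0F (W≋ 0F)
      1F → fixed 1F (W≋ 1F)
      2F → fixed 2F (W≋ 2F)
      5F → fixed 5F (W≋ 5F)
    where
    open ≋-Reasoning
    open Λ-identities {6 +ℕ n} using (∙−-cancel)
    fixed : ∀ q → W (q ↑ˡ n) ≋ E q → eval W (E q) ≋ E q
    fixed q = ≋-trans (eval-e W (q ↑ˡ n))
    eval-difference : eval W (E z − E y) ≋ W (z ↑ˡ n) − W (y ↑ˡ n)
    eval-difference = ≋-trans (eval-+Λ W (E z) (-Λ E y))
      (+Λ-cong (eval-e W (z ↑ˡ n)) (≋-trans (eval-neg W (E y)) (-Λ-cong (eval-e W (y ↑ˡ n)))))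
    unshear : ∀ q → W (q ↑ˡ n) ≋ E q +Λ (E y − E z) → eval W (E q +Λ (E z − E y)) ≋ E q
    unshear q Wq≋ = begin
      eval W (E q +Λ (E z − E y))               ≈⟨ eval-+Λ W (E q) (E z − E y) ⟩
      eval W (E q) +Λ eval W (E z − E y)        ≈⟨ +Λ-cong (eval-e W (q ↑ˡ n)) eval-difference ⟩
      W (q ↑ˡ n) +Λ (W (z ↑ˡ n) − W (y ↑ˡ n))   ≈⟨ +Λ-cong Wq≋ (−-cong Wz≋ Wy≋) ⟩
      (E q +Λ (E y − E z)) +Λ (E z − E y)       ≈⟨ ∙−-cancel (E q) (E y) (E z) ⟩
      E q                                       ∎

  local : ∀ {n} → Block → Block → Fin 6 → Λ (6 +ℕ n)
  local skew    meeting = shear (E 5F − E 0F)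
  local meeting skew    = shear (E 0F − E 5F)
  local skew    skew    = E
  local meeting meeting = E

  local-Homog : ∀ {n} b b′ p → Homog 1 (local {n} b b′ p)
  local-Homog skew    meeting = shear-Homog (Homog-− (E-Homog 5F) (E-Homog 0F))
  local-Homog meeting skew    = shear-Homog (Homog-− (E-Homog 0F) (E-Homog 5F))
  local-Homog skew    skew    = E-Homog
  local-Homog meeting meeting = E-Homog

  local-inverse : ∀ {n} b b′ (W : Fin (6 +ℕ n) → Λ (6 +ℕ n)) → (∀ q → W (q ↑ˡ n) ≋ local b′ b q) →
                  ∀ p → eval W (local b b′ p) ≋ E p
  local-inverse skew    meeting W W≋ = shear-inverse W {0F} {5F} (W≋ 0F) (W≋ 5F) W≋
  local-inverse meeting skew    W W≋ = shear-inverse W {5F} {0F} (W≋ 5F) (W≋ 0F) W≋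
  local-inverse {n} skew    skew    W W≋ p = ≋-trans (eval-e W (p ↑ˡ n)) (W≋ p)
  local-inverse {n} meeting meeting W W≋ p = ≋-trans (eval-e W (p ↑ˡ n)) (W≋ p)

  local-line₀₁₂ : ∀ {n} b b′ {q} → q ∈ line₀₁₂ → local {n} b b′ q ≡ E q
  local-line₀₁₂ skew    meeting = shear-line₀₁₂ _
  local-line₀₁₂ meeting skew    = shear-line₀₁₂ _
  local-line₀₁₂ skew    skew    _ = ≡-refl
  local-line₀₁₂ meeting meeting _ = ≡-refl

  local-diagonal : ∀ {n} b q → local {n} b b q ≡ E q
  local-diagonal skew    q = ≡-refl
  local-diagonal meeting q = ≡-refl

  blockSubst : ∀ {k} → Vec Block k → Vec Block k → Fin (k *ℕ 6) → Λ (k *ℕ 6)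
  blockSubst (b ∷ bs) (b′ ∷ bs′) i = [ local b b′ , shiftBy 6 ∘ blockSubst bs bs′ ]′ (splitAt 6 i)

  module _ {k} (b b′ : Block) (bs bs′ : Vec Block k) where

    blockSubst-↑ˡ : ∀ q → blockSubst (b ∷ bs) (b′ ∷ bs′) (q ↑ˡ _) ≡ local b b′ q
    blockSubst-↑ˡ q = cong [ local b b′ , shiftBy 6 ∘ blockSubst bs bs′ ]′ (splitAt-↑ˡ 6 q _)

    blockSubst-↑ʳ : ∀ j → blockSubst (b ∷ bs) (b′ ∷ bs′) (6 ↑ʳ j) ≡ shiftBy 6 (blockSubst bs bs′ j)
    blockSubst-↑ʳ j = cong [ local b b′ , shiftBy 6 ∘ blockSubst bs bs′ ]′ (splitAt-↑ʳ 6 _ j)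

  blockSubst-Homog : ∀ {k} (bs bs′ : Vec Block k) i → Homog 1 (blockSubst bs bs′ i)
  blockSubst-Homog (b ∷ bs) (b′ ∷ bs′) i with sumView 6 i
  ... | inl q = Homog-cong (≋-reflexive (≡-sym (blockSubst-↑ˡ b b′ bs bs′ q))) (local-Homog b b′ q)
  ... | inr j = Homog-cong (≋-reflexive (≡-sym (blockSubst-↑ʳ b b′ bs bs′ j))) (shiftBy-Homog 6 (blockSubst-Homog bs bs′ j))

  blockSubst-inverse : ∀ {k} (bs bs′ : Vec Block k) i → eval (blockSubst bs′ bs) (blockSubst bs bs′ i) ≋ e i
  blockSubst-inverse {suc k} (b ∷ bs) (b′ ∷ bs′) i = by-view (sumView 6 i)
    where
    open ≋-Reasoning
    V = blockSubst (b ∷ bs) (b′ ∷ bs′)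
    W = blockSubst (b′ ∷ bs′) (b ∷ bs)
    by-view : ∀ {i} → SumView 6 (k *ℕ 6) i → eval W (V i) ≋ e i
    by-view (inl q) = ≋-trans (eval-cong W (≋-reflexive (blockSubst-↑ˡ b b′ bs bs′ q)))
                        (local-inverse b b′ W (≋-reflexive ∘ blockSubst-↑ˡ b′ b bs′ bs) q)
    by-view (inr j) = begin
      eval W (V (6 ↑ʳ j))                                        ≈⟨ eval-cong W (≋-reflexive (blockSubst-↑ʳ b b′ bs bs′ j)) ⟩
      eval W (shiftBy 6 (blockSubst bs bs′ j))                   ≈⟨ eval-shiftBy 6 W (blockSubst bs bs′ j) ⟩
      eval (W ∘ (6 ↑ʳ_)) (blockSubst bs bs′ j)                   ≈⟨ eval-congᵛ (≋-reflexive ∘ blockSubst-↑ʳ b′ b bs′ bs) (blockSubst bs bs′ j) ⟩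
      eval (shiftBy 6 ∘ blockSubst bs′ bs) (blockSubst bs bs′ j) ≈⟨ eval-shiftByᵛ 6 (blockSubst bs′ bs) (blockSubst bs bs′ j) ⟩
      shiftBy 6 (eval (blockSubst bs′ bs) (blockSubst bs bs′ j)) ≈⟨ shiftBy-cong 6 (blockSubst-inverse bs bs′ j) ⟩
      shiftBy 6 (e j)                                            ≈⟨ e-↑ʳ 6 j ⟨
      e (6 ↑ʳ j)                                                 ∎

  module _ {n : ℕ} where
    open ≋-Reasoning
    open Λ-identities {6 +ℕ n} using (−-cancelʳ; ∙−-identity; −-regroup)

    sheared-line₃₄₅ : ∂₃ (E 3F +Λ (E 5F − E 0F)) (E 4F +Λ (E 5F − E 0F)) (E 5F) ≋ ∂e (line₀₃₄ ++ ⊥ {n})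
    sheared-line₃₄₅ = begin
      ∂₃ (E 3F +Λ s) (E 4F +Λ s) (E 5F)
        ≈⟨ *Λ-cong (−-cancelʳ (E 3F) (E 4F) s) (≋-trans (−-cong ≋-refl (≋-sym (∙−-identity (E 0F) (E 5F)))) (−-cancelʳ (E 4F) (E 0F) s)) ⟩
      ∂₃ (E 3F) (E 4F) (E 0F)   ≈⟨ ∂₃-rotate (E-Homog 0F) (E-Homog 3F) (E-Homog 4F) ⟩
      ∂₃ (E 0F) (E 3F) (E 4F)   ≈⟨ ∂e-line₀₃₄ ⟨
      ∂e (line₀₃₄ ++ ⊥)         ∎
      where s = E 5F − E 0F

    sheared-line₀₃₄ : ∂₃ (E 0F) (E 3F +Λ (E 0F − E 5F)) (E 4F +Λ (E 0F − E 5F)) ≋ ∂e (line₃₄₅ ++ ⊥ {n})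
    sheared-line₀₃₄ = begin
      ∂₃ (E 0F) (E 3F +Λ s) (E 4F +Λ s)
        ≈⟨ *Λ-cong (≋-trans (−-cong (≋-sym (∙−-identity (E 5F) (E 0F))) ≋-refl) (−-cancelʳ (E 5F) (E 3F) s)) (−-cancelʳ (E 3F) (E 4F) s) ⟩
      ∂₃ (E 5F) (E 3F) (E 4F)   ≈⟨ ∂₃-rotate (E-Homog 5F) (E-Homog 3F) (E-Homog 4F) ⟨
      ∂₃ (E 3F) (E 4F) (E 5F)   ≈⟨ ∂e-line₃₄₅ ⟨
      ∂e (line₃₄₅ ++ ⊥)         ∎
      where s = E 0F − E 5F

    sheared-circuit₁₂₃₄ : -Λ ((E 1F − E 2F) *Λ ∂₃ (E 2F) (E 3F +Λ (E 0F − E 5F)) (E 4F +Λ (E 0F − E 5F)))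
                          ≋ -Λ ((∂e (line₀₁₂ ++ ⊥ {n}) *Λ (E 3F − E 4F)) +Λ ((E 1F − E 2F) *Λ ∂e (line₃₄₅ ++ ⊥)))
    sheared-circuit₁₂₃₄ = -Λ-cong (begin
      (E 1F − E 2F) *Λ ((E 2F − (E 3F +Λ s)) *Λ ((E 3F +Λ s) − (E 4F +Λ s)))
        ≈⟨ *Λ-cong ≋-refl (*Λ-cong (−-regroup (E 2F) (E 3F) (E 0F) (E 5F)) (−-cancelʳ (E 3F) (E 4F) s)) ⟩
      (E 1F − E 2F) *Λ (((E 2F − E 0F) +Λ (E 5F − E 3F)) *Λ (E 3F − E 4F))
        ≈⟨ *Λ-cong ≋-refl (*Λ-distribʳ _ _ _) ⟩
      (E 1F − E 2F) *Λ (((E 2F − E 0F) *Λ (E 3F − E 4F)) +Λ ∂₃ (E 5F) (E 3F) (E 4F))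
        ≈⟨ *Λ-distribˡ _ _ _ ⟩
      ((E 1F − E 2F) *Λ ((E 2F − E 0F) *Λ (E 3F − E 4F))) +Λ ((E 1F − E 2F) *Λ ∂₃ (E 5F) (E 3F) (E 4F))
        ≈⟨ +Λ-cong (≋-sym (*Λ-assoc _ _ _)) ≋-refl ⟩
      (∂₃ (E 1F) (E 2F) (E 0F) *Λ (E 3F − E 4F)) +Λ ((E 1F − E 2F) *Λ ∂₃ (E 5F) (E 3F) (E 4F))
        ≈⟨ +Λ-cong (*Λ-cong (∂₃-rotate (E-Homog 0F) (E-Homog 1F) (E-Homog 2F)) ≋-refl)
                   (*Λ-cong ≋-refl (≋-sym (∂₃-rotate (E-Homog 5F) (E-Homog 3F) (E-Homog 4F)))) ⟩
      (∂₃ (E 0F) (E 1F) (E 2F) *Λ (E 3F − E 4F)) +Λ ((E 1F − E 2F) *Λ ∂₃ (E 3F) (E 4F) (E 5F))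
        ≈⟨ +Λ-cong (*Λ-cong ∂e-line₀₁₂ ≋-refl) (*Λ-cong ≋-refl ∂e-line₃₄₅) ⟨
      (∂e (line₀₁₂ ++ ⊥) *Λ (E 3F − E 4F)) +Λ ((E 1F − E 2F) *Λ ∂e (line₃₄₅ ++ ⊥)) ∎)
      where s = E 0F − E 5F

  module _ {k : ℕ} (b b′ : Block) (bs bs′ : Vec Block k) where
    private
      V = blockSubst (b ∷ bs) (b′ ∷ bs′)
      M′ = block b′ ⊕ blockSum bs′

    generator : ∀ {C} → C ∈ᴸ circuits b′ → InI M′ (∂e (C ++ ⊥))
    generator C∈ = InI-++⊥ (block b′) (blockSum bs′) (block-circuit b′ C∈)

    fixed-circuit : ∀ {C} → C ∈ᴸ circuits b′ → (∀ {q} → q ∈ C → local b b′ q ≡ E q) → InI M′ (eval V (∂e (C ++ ⊥)))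
    fixed-circuit {C} C∈ fixes = InI-cong M′ (≋-sym (eval-∂e-fixed (C ++ ⊥) V≋e)) (generator C∈)
      where
      V≋e : ∀ {i} → i ∈ C ++ ⊥ → V i ≋ e i
      V≋e {i} i∈ with sumView 6 i
      ... | inl q = ≋-reflexive (≡-trans (blockSubst-↑ˡ b b′ bs bs′ q) (fixes (∈-++⁻ˡ C i∈)))
      ... | inr j = contradiction (∈-++⁻ʳ C i∈) ∉⊥

  local-circuit-image : ∀ {k} b b′ (bs bs′ : Vec Block k) {C} → C ∈ᴸ circuits b →
                        InI (block b′ ⊕ blockSum bs′) (eval (blockSubst (b ∷ bs) (b′ ∷ bs′)) (∂e (C ++ ⊥)))
  local-circuit-image skew    skew    bs bs′ C∈ = fixed-circuit skew skew bs bs′ C∈ λ {q} _ → local-diagonal skew q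
  local-circuit-image meeting meeting bs bs′ C∈ = fixed-circuit meeting meeting bs bs′ C∈ λ {q} _ → local-diagonal meeting q
  local-circuit-image skew    meeting bs bs′ (here ≡-refl) = fixed-circuit skew meeting bs bs′ (here ≡-refl) (local-line₀₁₂ skew meeting)
  local-circuit-image meeting skew    bs bs′ (here ≡-refl) = fixed-circuit meeting skew bs bs′ (here ≡-refl) (local-line₀₁₂ meeting skew)
  local-circuit-image skew    meeting bs bs′ (there (here ≡-refl)) =
    InI-cong (block meeting ⊕ blockSum bs′) (≋-sym (≋-trans (eval-∂e-line₃₄₅ V (blockSubst-Homog (skew ∷ bs) (meeting ∷ bs′))) sheared-line₃₄₅)) (generator skew meeting bs bs′ (there (here ≡-refl)))
    where V = blockSubst (skew ∷ bs) (meeting ∷ bs′)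
  local-circuit-image meeting skew    bs bs′ (there (here ≡-refl)) =
    InI-cong (block skew ⊕ blockSum bs′) (≋-sym (≋-trans (eval-∂e-line₀₃₄ V (blockSubst-Homog (meeting ∷ bs) (skew ∷ bs′))) sheared-line₀₃₄)) (generator meeting skew bs bs′ (there (here ≡-refl)))
    where V = blockSubst (meeting ∷ bs) (skew ∷ bs′)
  local-circuit-image meeting skew    bs bs′ (there (there (here ≡-refl))) =
    InI-cong M′ (≋-sym (≋-trans (eval-∂e-circuit₁₂₃₄ V (blockSubst-Homog (meeting ∷ bs) (skew ∷ bs′))) sheared-circuit₁₂₃₄))
      (InI-neg M′ (InI-+ M′ (InI-*ʳ M′ (E 3F − E 4F) (generator meeting skew bs bs′ (here ≡-refl)))
                            (InI-*ˡ M′ (E 1F − E 2F) (generator meeting skew bs bs′ (there (here ≡-refl))))))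
    where
    V = blockSubst (meeting ∷ bs) (skew ∷ bs′)
    M′ = block skew ⊕ blockSum bs′

  blockSubst-circuits : ∀ {k} (bs bs′ : Vec Block k) {C} → IsCircuit (blockSum bs) C →
                        InI (blockSum bs′) (eval (blockSubst bs bs′) (∂e C))
  blockSubst-circuits []       []         (dep , _) = contradiction tt dep
  blockSubst-circuits (b ∷ bs) (b′ ∷ bs′) {C} circ = [ in-block , in-rest ]′ (circuit-⊕ (block b) (blockSum bs) circ)
    where
    open ≋-Reasoning
    V = blockSubst (b ∷ bs) (b′ ∷ bs′)
    M′ = blockSum (b′ ∷ bs′)
    in-block : ∃ (λ B → IsCircuit (block b) B × C ≡ B ++ ⊥) → InI M′ (eval V (∂e C))
    in-block (B , B-circ , C≡) = subst (λ D → InI M′ (eval V (∂e D))) (≡-sym C≡) (local-circuit-image b b′ bs bs′ (block-circuit⁻ b B-circ))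
    in-rest : ∃ (λ D → IsCircuit (blockSum bs) D × C ≡ ⊥ ++ D) → InI M′ (eval V (∂e C))
    in-rest (D , D-circ , C≡) = subst (λ D → InI M′ (eval V (∂e D))) (≡-sym C≡)
      (InI-cong M′ (≋-sym shifted) (InI-shiftBy (block b′) (blockSum bs′) (blockSubst-circuits bs bs′ D-circ)))
      where
      shifted : eval V (∂e (⊥ ++ D)) ≋ shiftBy 6 (eval (blockSubst bs bs′) (∂e D))
      shifted = begin
        eval V (∂e (⊥ ++ D))                                 ≈⟨ eval-cong V (∂e-⊥++ 6 D) ⟩
        eval V (shiftBy 6 (∂e D))                            ≈⟨ eval-shiftBy 6 V (∂e D) ⟩
        eval (V ∘ (6 ↑ʳ_)) (∂e D)                            ≈⟨ eval-congᵛ (≋-reflexive ∘ blockSubst-↑ʳ b b′ bs bs′) (∂e D) ⟩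
        eval (shiftBy 6 ∘ blockSubst bs bs′) (∂e D)          ≈⟨ eval-shiftByᵛ 6 (blockSubst bs bs′) (∂e D) ⟩
        shiftBy 6 (eval (blockSubst bs bs′) (∂e D))          ∎

  blockSum-OSIso : ∀ {k} (bs bs′ : Vec Block k) → OSIso (blockSum bs) (blockSum bs′)
  blockSum-OSIso bs bs′ = substitutionIso {M = blockSum bs} {blockSum bs′} (blockSubst bs bs′) (blockSubst bs′ bs)
    (blockSubst-Homog bs bs′) (blockSubst-Homog bs′ bs) (blockSubst-inverse bs bs′) (blockSubst-inverse bs′ bs)
    (blockSubst-circuits bs bs′) (blockSubst-circuits bs′ bs)

corollary1p2 : ∀ {c ℓ : Level} (K : CommutativeRing c ℓ) (m : ℕ) → 1 ≤ m →
    Σ (Fin m → ℕ) λ n →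
    Σ ((i : Fin m) → Matroid (n i)) λ M →
      (∀ i → Simple (M i)) ×
      (∀ i j → i ≢ j → ¬ (M i ≅M M j)) ×
      (∀ i j → OS.OSIso K (M i) (M j))
corollary1p2 K m _ = (λ _ → m *ℕ 6) , blockSum ∘ shape , blockSum-simple ∘ shape , non-isomorphic , OS-isomorphic
  where
  shape : Fin m → Vec Block m
  shape i = meetingThenSkew (toℕ i) m
  non-isomorphic : ∀ i j → i ≢ j → ¬ (blockSum (shape i) ≅M blockSum (shape j))
  non-isomorphic i j i≢j = blockSum-≇ (shape i) (shape j) λ eq → i≢j (toℕ-injective
    (≡-trans (≡-sym (#coloops-meetingThenSkew (toℕ≤n i))) (≡-trans eq (#coloops-meetingThenSkew (toℕ≤n j)))))
  OS-isomorphic : ∀ i j → OS.OSIso K (blockSum (shape i)) (blockSum (shape j))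
  OS-isomorphic i j = BlockSubstitution.blockSum-OSIso K (shape i) (shape j)
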